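{- Let $L$ be a lattice of rank $\ell$, let $\Gamma$ be a finite group with an injective homomorphism $\rho:\Gamma\to\mathrm{GL}(L)$, and let $\mathcal{A}=\{H_1,\dots,H_n\}$, $H_i=\{x\in L_{\mathbb{R}}:\alpha_i(x)=0\}$ with nonzero $\alpha_1,\dots,\alpha_n\in L^\vee$, be a $\Gamma$-invariant arrangement. Then the function $q\mapsto \chi_{\mathcal{A},q}$ ($q\in\mathbb{Z}_{>0}$), taking values in the ring of $\mathbb{C}$-valued class functions on $\Gamma$, is a quasi-polynomial in $q$. Furthermore, it has the gcd-property.
   Context: $L^\vee=\mathrm{Hom}_{\mathbb{Z}}(L,\mathbb{Z})$, $L_{\mathbb{R}}=L\otimes\mathbb{R}$. For $q\in\mathbb{Z}_{>0}$, $L_q=L/qL$ with projection $\pi_q:L\to L_q$, and $\Gamma$ acts on $L_q$ by $\rho_q$ with $\rho_q(\gamma)\circ\pi_q=\pi_q\circ\rho(\gamma)$, and on $L^\vee$ by $\rho^\vee(\gamma)(\alpha)=\alpha\circ\rho(\gamma)^{ -1}$. $\mathcal{A}$ is $\Gamma$-invariant if $\rho^\vee(\gamma)(\{\pm\alpha_1,\dots,\pm\alpha_n\})=\{\pm\alpha_1,\dots,\pm\alpha_n\}$ for all $\gamma\in\Gamma$. Set $M(\mathcal{A};q)=\{\pi_q(x)\in L_q : \alpha_i(x)\not\equiv 0 \pmod q \text{ for all } i\}$; this set is $\Gamma$-stable and $\chi_{\mathcal{A},q}$ denotes the permutation character of $\Gamma$ on it, i.e. $\chi_{\mathcal{A},q}(\gamma)=\#\{\bar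 x\in M(\mathcal{A};q):\rho_q(\gamma)(\bar x)=\bar x\}$. A function $F:\mathbb{Z}_{>0}\to R$ ($R$ a commutative ring) is a quasi-polynomial if there are $\tilde n\in\mathbb{Z}_{>0}$ (a period) and polynomials $f^{(1)},\dots,f^{(\tilde n)}\in R[t]$ (constituents) with $F(z)=f^{(r)}(z)$ whenever $z\equiv r\pmod{\tilde n}$; it has the gcd-property if (for some period $\tilde n$) $\gcd\{\tilde n,r_1\}=\gcd\{\tilde n,r_2\}$ implies $f^{(r_1)}=f^{(r_2)}$. -}

module Defs where

open import Level using (0ℓ)
open import Algebra.Bundles using (Group)
open import Data.Nat as ℕ using (ℕ; zero; suc; NonZero; _<_)
open import Data.Nat.GCD using (gcd)
open import Data.Nat.DivMod using (_%_; m%n<n)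
open import Data.Integer as ℤ using (ℤ; +_; _%ℕ_)
open import Data.Rational as ℚ using (ℚ; 0ℚ; 1ℚ)
open import Data.Fin as Fin using (Fin; toℕ; fromℕ<)
open import Data.Fin.Properties using (all?)
import Data.Vec.Functional as VF
open import Data.List using (List; []; _∷_; map; concatMap; filter; length; allFin)
open import Data.Product using (Σ; Σ-syntax; ∃; ∃-syntax; _×_; _,_)
open import Data.Sum using (_⊎_)
open import Relation.Nullary using (¬_; Dec; yes; no)
open import Relation.Nullary.Decidable using (_×-dec_; ¬?)
open import Relation.Binary.PropositionalEquality using (_≡_)

-- Linear algebra over ℤ on the lattice L = ℤ^ℓ (coordinates w.r.t. a basis)

sumℤ : (n : ℕ) → (Fin n → ℤ) → ℤ
sumℤ zero    f = + 0
sumℤ (suc n) f = f Fin.zero ℤ.+ sumℤ n (λ k → f (Fin.suc k))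

-- elements of L (column vectors) and of L^∨ (row vectors / linear forms)
Vecℤ : ℕ → Set
Vecℤ ℓ = Fin ℓ → ℤ

Mat : ℕ → Set
Mat ℓ = Fin ℓ → Fin ℓ → ℤ

_·ₘ_ : {ℓ : ℕ} → Mat ℓ → Mat ℓ → Mat ℓ
_·ₘ_ {ℓ} A B i j = sumℤ ℓ (λ k → A i k ℤ.* B k j)

idMat : (ℓ : ℕ) → Mat ℓ
idMat ℓ i j with i Fin.≟ j
... | yes _ = + 1
... | no  _ = + 0

applyMat : {ℓ : ℕ} → Mat ℓ → Vecℤ ℓ → Vecℤ ℓ
applyMat {ℓ} M x i = sumℤ ℓ (λ k → M i k ℤ.* x k)

evalForm : {ℓ : ℕ} → Vecℤ ℓ → Vecℤ ℓ → ℤ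
evalForm {ℓ} α x = sumℤ ℓ (λ k → α k ℤ.* x k)

formComp : {ℓ : ℕ} → Vecℤ ℓ → Mat ℓ → Vecℤ ℓ
formComp {ℓ} α M j = sumℤ ℓ (λ k → α k ℤ.* M k j)

IsFiniteGroup : Group 0ℓ 0ℓ → Set
IsFiniteGroup Γ = ∃[ m ] Σ[ e ∈ (Fin m → Carrier) ] (∀ g → ∃[ i ] (e i ≈ g))
  where open Group Γ

-- ρ : Γ → GL(L) is a group homomorphism (its image then lies in GL(L),
-- with ρ(γ)^{-1} = ρ(γ⁻¹))
IsRepHom : {ℓ : ℕ} (Γ : Group 0ℓ 0ℓ) → (Group.Carrier Γ → Mat ℓ) → Set
IsRepHom {ℓ} Γ ρ =
    (∀ g h → g ≈ h → ∀ i j → ρ g i j ≡ ρ h i j)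
  × (∀ g h → ∀ i j → ρ (g ∙ h) i j ≡ (ρ g ·ₘ ρ h) i j)
  × (∀ i j → ρ ε i j ≡ idMat ℓ i j)
  where open Group Γ

IsInjectiveRep : {ℓ : ℕ} (Γ : Group 0ℓ 0ℓ) → (Group.Carrier Γ → Mat ℓ) → Set
IsInjectiveRep Γ ρ = ∀ g h → (∀ i j → ρ g i j ≡ ρ h i j) → g ≈ h
  where open Group Γ

dualAction : {ℓ : ℕ} (Γ : Group 0ℓ 0ℓ) → (Group.Carrier Γ → Mat ℓ) →
             Group.Carrier Γ → Vecℤ ℓ → Vecℤ ℓ
dualAction Γ ρ γ α = formComp α (ρ (γ ⁻¹))
  where open Group Γ

-- the arrangement given by α₁,…,αₙ is Γ-invariant:
-- ρ^∨(γ) maps {±α₁,…,±αₙ} into (hence onto) itself for every γ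
IsΓInvariant : {ℓ n : ℕ} (Γ : Group 0ℓ 0ℓ) → (Group.Carrier Γ → Mat ℓ) →
               (Fin n → Vecℤ ℓ) → Set
IsΓInvariant Γ ρ α =
  ∀ γ i → ∃[ j ] ((∀ k → dualAction Γ ρ γ (α i) k ≡ α j k)
                 ⊎ (∀ k → dualAction Γ ρ γ (α i) k ≡ ℤ.- α j k))

-- L_q = L/qL, represented by vectors with coordinates in {0,…,q-1}

Lq : ℕ → ℕ → Set
Lq ℓ q = Fin ℓ → Fin q

allLq : (ℓ q : ℕ) → List (Lq ℓ q)
allLq zero    q = VF.[] ∷ []
allLq (suc ℓ) q = concatMap (λ a → map (λ v → a VF.∷ v) (allLq ℓ q)) (allFin q)

liftLq : {ℓ q : ℕ} → Lq ℓ q → Vecℤ ℓ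
liftLq x k = + toℕ (x k)

FixedBy : {ℓ : ℕ} (q : ℕ) .{{_ : NonZero q}} → Mat ℓ → Lq ℓ q → Set
FixedBy q M x = ∀ k → applyMat M (liftLq x) k %ℕ q ≡ toℕ (x k)

InComplement : {ℓ n : ℕ} (q : ℕ) .{{_ : NonZero q}} → (Fin n → Vecℤ ℓ) → Lq ℓ q → Set
InComplement q α x = ∀ i → ¬ (evalForm (α i) (liftLq x) %ℕ q ≡ 0)

fixedBy? : {ℓ : ℕ} (q : ℕ) .{{_ : NonZero q}} (M : Mat ℓ) (x : Lq ℓ q) → Dec (FixedBy q M x)
fixedBy? q M x = all? (λ k → applyMat M (liftLq x) k %ℕ q ℕ.≟ toℕ (x k))

inComplement? : {ℓ n : ℕ} (q : ℕ) .{{_ : NonZero q}} (α : Fin n → Vecℤ ℓ) (x : Lq ℓ q) →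
                Dec (InComplement q α x)
inComplement? q α x = all? (λ i → ¬? (evalForm (α i) (liftLq x) %ℕ q ℕ.≟ 0))

permChar : {ℓ n : ℕ} (Γ : Group 0ℓ 0ℓ) → (Group.Carrier Γ → Mat ℓ) →
           (Fin n → Vecℤ ℓ) → (q : ℕ) .{{_ : NonZero q}} → Group.Carrier Γ → ℕ
permChar {ℓ} Γ ρ α q γ =
  length (filter (λ x → inComplement? q α x ×-dec fixedBy? q (ρ γ) x) (allLq ℓ q))

-- Quasi-polynomials with values in the ring of (ℚ-valued) class functions on Γ

evalPoly : (d : ℕ) → (Fin (suc d) → ℚ) → ℚ → ℚ
evalPoly zero    c z = c Fin.zero
evalPoly (suc d) c z = c Fin.zero ℚ.+ z ℚ.* evalPoly d (λ i → c (Fin.suc i)) z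

ℕtoℚ : ℕ → ℚ
ℕtoℚ n = + n ℚ./ 1

-- a polynomial of degree ≤ d over the ring of class functions on Γ:
-- coefficient i is the class function γ ↦ f γ i
IsClassFunctionPoly : (Γ : Group 0ℓ 0ℓ) (d : ℕ) → (Group.Carrier Γ → Fin (suc d) → ℚ) → Set
IsClassFunctionPoly Γ d f =
    (∀ g h → g ≈ h → ∀ i → f g i ≡ f h i)
  × (∀ g γ → ∀ i → f ((g ∙ γ) ∙ g ⁻¹) i ≡ f γ i)
  where open Group Γ

evalCFPoly : (Γ : Group 0ℓ 0ℓ) (d : ℕ) → (Group.Carrier Γ → Fin (suc d) → ℚ) →
             ℕ → Group.Carrier Γ → ℚ
evalCFPoly Γ d f z γ = evalPoly d (f γ) (ℕtoℚ z)

-- F is a quasi-polynomial with period ñ and constituents f^(r) (r = residue of z mod ñ;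
-- the residue 0 plays the role of r = ñ), and it has the gcd-property for this period.
IsQuasiPolyWithGcd : (Γ : Group 0ℓ 0ℓ) →
                     ((z : ℕ) → .{{_ : NonZero z}} → Group.Carrier Γ → ℚ) → Set
IsQuasiPolyWithGcd Γ F =
  Σ[ ñ ∈ ℕ ] Σ[ ñ≢0 ∈ NonZero ñ ] Σ[ d ∈ ℕ ]
  Σ[ f ∈ (Fin ñ → Group.Carrier Γ → Fin (suc d) → ℚ) ]
      (∀ r → IsClassFunctionPoly Γ d (f r))
    × (∀ (z : ℕ) .{{_ : NonZero z}} → ∀ γ →
         F z γ ≡ evalCFPoly Γ d (f (fromℕ< (m%n<n z ñ {{ñ≢0}}))) z γ)
    × (∀ r₁ r₂ → gcd ñ (toℕ r₁) ≡ gcd ñ (toℕ r₂) → ∀ γ i → f r₁ γ i ≡ f r₂ γ i)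

{-# OPTIONS --safe #-}
-- χ_{A,q}(γ) counts the x̄ ∈ L_q with (ρ(γ) − 1)x ≡ 0 (mod q) at which no αᵢ vanishes mod q.
-- Inclusion–exclusion over the αᵢ writes this as a signed sum of numbers of solutions of
-- homogeneous linear systems mod q. Bringing such a system to Smith normal form diag(d₁, …, dᵣ, 0, …, 0)
-- by unimodular row and column operations shows that it has q^(ℓ−r) ∏ gcd(dᵢ, q) solutions: a polynomial
-- in q that depends on q only through gcd(∏ dᵢ, q). Taking a common period over an enumeration of Γ gives
-- the quasi-polynomial with the gcd-property. Its constituents are class functions because χ_{A,q} is,
-- and a polynomial is determined by its values on an arithmetic progression.
module Submission where

open import Defs
open import Level using (0ℓ)
open import Algebra.Bundles using (Group)
import Algebra.Properties.CommutativeMonoid.Sum as CommutativeMonoidSum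
import Algebra.Properties.Group as GroupProperties
import Algebra.Properties.Semiring.Sum as SemiringSum
open import Data.Empty using (⊥-elim)
open import Data.Fin as Fin using (Fin; zero; suc; toℕ; fromℕ<; combine; finToFun; funToFin)
import Data.Fin.Permutation as Perm
import Data.Fin.Properties as FinP
open import Data.Integer as ℤ using (ℤ; +_; -[1+_]; _+_; _*_; -_; _-_; 0ℤ; 1ℤ; -1ℤ; ∣_∣; _%ℕ_; _/ℕ_)
import Data.Integer.DivMod as ℤD
open import Data.Integer.Divisibility.Signed as ℤDv using (_∣_; divides)
import Data.Integer.Properties as ℤP
open import Data.Integer.Tactic.RingSolver using (solve-∀)
open import Data.List using (List; []; _∷_; map; filter; length; allFin; concatMap)
import Data.List as List
open import Data.List.Membership.Propositional.Properties using (∈-tabulate⁺)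
import Data.List.Properties as ListP
open import Data.List.Relation.Unary.All as All using (All; []; _∷_)
import Data.List.Relation.Unary.All.Properties as AllP
open import Data.Nat as ℕ using (ℕ; zero; suc; NonZero; _^_; _≤_; _<_; _%_; _/_; z≤n; s≤s)
import Data.Nat.Coprimality as Coprime
import Data.Nat.DivMod as ℕD
open import Data.Nat.Divisibility as ℕDv using (_∣?_)
open import Data.Nat.GCD using (gcd; gcd-GCD; gcd-assoc; gcd-comm; gcd-greatest; module GCD)
open import Data.Nat.GCD using (gcd[m,n]∣m; gcd[m,n]∣n; gcd[m,n]≡0⇒m≡0; gcd[m,n]≡0⇒n≡0)
import Data.Nat.GCD as ℕGCD
import Data.Nat.ListAction as ℕL
import Data.Nat.ListAction.Properties as ℕLP
import Data.Nat.Properties as ℕP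
import Data.Nat.Tactic.RingSolver as ℕRing
open import Data.Product using (Σ-syntax; ∃-syntax; ∃₂; _×_; _,_; proj₁; proj₂; map₂)
open import Data.Rational as ℚ using (ℚ; mkℚ)
import Data.Rational.Properties as ℚP
open import Data.Sum as Sum using (_⊎_; inj₁; inj₂)
import Data.Vec.Functional as VF
open import Function using (_∘_; id; _⇔_; mk⇔)
open import Function.Bundles using (Inverse; module Equivalence)
import Function.Consequences.Setoid as FunctionConsequences
open import Function.Definitions using (Congruent)
open import Function.Properties.Equivalence using (⇔-isEquivalence)
open import Relation.Binary.Bundles using (Setoid)
open import Relation.Binary.PropositionalEquality
import Relation.Binary.Reasoning.Setoid as SetoidReasoning
open import Relation.Binary.Structures using (IsEquivalence)
open import Relation.Nullary using (¬_; Dec; yes; no)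
open import Relation.Nullary.Decidable using (_×-dec_; ¬?)

private
  module ℤΣ = CommutativeMonoidSum ℤP.+-0-commutativeMonoid
  module ℤΣ* = SemiringSum ℤP.+-*-semiring
  module ℕΣ = CommutativeMonoidSum ℕP.+-0-commutativeMonoid
  module ℕΣ* = SemiringSum ℕP.+-*-semiring

  variable
    k ℓ : ℕ

  open IsEquivalence (⇔-isEquivalence {ℓ = 0ℓ}) using () renaming (refl to ⇔-refl; sym to ⇔-sym; trans to ⇔-trans)

-- Congruences modulo q

infix 4 _≡_[mod_]

record _≡_[mod_] (a b : ℤ) (q : ℕ) : Set where
  constructor ≡-mod
  field ∣-difference : + q ∣ a - b
open _≡_[mod_] public

module _ {q : ℕ} where

  ≡-mod-reflexive : ∀ {a b} → a ≡ b → a ≡ b [mod q ]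
  ≡-mod-reflexive {a} refl =
    ≡-mod (divides 0ℤ (trans (ℤP.+-inverseʳ a) (sym (ℤP.*-zeroˡ (+ q)))))

  ≡-mod-refl : ∀ {a} → a ≡ a [mod q ]
  ≡-mod-refl = ≡-mod-reflexive refl

  ≡-mod-sym : ∀ {a b} → a ≡ b [mod q ] → b ≡ a [mod q ]
  ≡-mod-sym {a} {b} (≡-mod q∣a-b) = ≡-mod (subst (+ q ∣_) (lemma a b) (ℤDv.∣m⇒∣-m q∣a-b))
    where
    lemma : ∀ a b → - (a - b) ≡ b - a
    lemma = solve-∀

  ≡-mod-trans : ∀ {a b c} → a ≡ b [mod q ] → b ≡ c [mod q ] → a ≡ c [mod q ]
  ≡-mod-trans {a} {b} {c} (≡-mod q∣a-b) (≡-mod q∣b-c) =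
    ≡-mod (subst (+ q ∣_) (lemma a b c) (ℤDv.∣m∣n⇒∣m+n q∣a-b q∣b-c))
    where
    lemma : ∀ a b c → (a - b) + (b - c) ≡ a - c
    lemma = solve-∀

  ≡-mod-isEquivalence : IsEquivalence _≡_[mod q ]
  ≡-mod-isEquivalence = record { refl = ≡-mod-refl ; sym = ≡-mod-sym ; trans = ≡-mod-trans }

  +-cong-mod : ∀ {a b c d} → a ≡ b [mod q ] → c ≡ d [mod q ] → a + c ≡ b + d [mod q ]
  +-cong-mod {a} {b} {c} {d} (≡-mod q∣a-b) (≡-mod q∣c-d) =
    ≡-mod (subst (+ q ∣_) (lemma a b c d) (ℤDv.∣m∣n⇒∣m+n q∣a-b q∣c-d))
    where
    lemma : ∀ a b c d → (a - b) + (c - d) ≡ (a + c) - (b + d)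
    lemma = solve-∀

  neg-cong-mod : ∀ {a b} → a ≡ b [mod q ] → - a ≡ - b [mod q ]
  neg-cong-mod {a} {b} (≡-mod q∣a-b) = ≡-mod (subst (+ q ∣_) (lemma a b) (ℤDv.∣m⇒∣-m q∣a-b))
    where
    lemma : ∀ a b → - (a - b) ≡ - a - - b
    lemma = solve-∀

  *-congˡ-mod : ∀ c {a b} → a ≡ b [mod q ] → c * a ≡ c * b [mod q ]
  *-congˡ-mod c {a} {b} (≡-mod q∣a-b) = ≡-mod (subst (+ q ∣_) (lemma c a b) (ℤDv.∣n⇒∣m*n c q∣a-b))
    where
    lemma : ∀ c a b → c * (a - b) ≡ c * a - c * b
    lemma = solve-∀

  ≡0-mod⇒∣ : ∀ {a} → a ≡ 0ℤ [mod q ] → + q ∣ a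
  ≡0-mod⇒∣ {a} (≡-mod q∣a-0) = subst (+ q ∣_) (ℤP.+-identityʳ a) q∣a-0

  ∣⇒≡0-mod : ∀ {a} → + q ∣ a → a ≡ 0ℤ [mod q ]
  ∣⇒≡0-mod {a} q∣a = ≡-mod (subst (+ q ∣_) (sym (ℤP.+-identityʳ a)) q∣a)

≡-mod-setoid : ℕ → Setoid 0ℓ 0ℓ
≡-mod-setoid q = record { isEquivalence = ≡-mod-isEquivalence {q} }

module ≡-mod-Reasoning (q : ℕ) = SetoidReasoning (≡-mod-setoid q)

private
  multiple<⇒≡0 : ∀ {q d} → d < q → q ℕDv.∣ d → d ≡ 0
  multiple<⇒≡0 {d = zero}  _   _   = refl
  multiple<⇒≡0 {d = suc _} d<q q∣d = ⊥-elim (ℕDv.>⇒∤ d<q q∣d)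

  residue-unique-≤ : ∀ {q r s} → r < q → s ℕ.≤ r → + r ≡ + s [mod q ] → r ≡ s
  residue-unique-≤ {q} {r} {s} r<q s≤r (≡-mod q∣r-s) =
    ℕP.≤-antisym (ℕP.m∸n≡0⇒m≤n (multiple<⇒≡0 (ℕP.≤-<-trans (ℕP.m∸n≤m r s) r<q) q∣r∸s)) s≤r
    where
    q∣r∸s : q ℕDv.∣ r ℕ.∸ s
    q∣r∸s = subst (λ d → q ℕDv.∣ ℤ.∣ d ∣) (trans (ℤP.m-n≡m⊖n r s) (ℤP.⊖-≥ s≤r)) (ℤDv.∣⇒∣ᵤ q∣r-s)

residue-unique : ∀ {q r s} → r < q → s < q → + r ≡ + s [mod q ] → r ≡ s
residue-unique r<q s<q r≡s with ℕP.≤-total _ _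
... | inj₁ s≤r = residue-unique-≤ r<q s≤r r≡s
... | inj₂ r≤s = sym (residue-unique-≤ s<q r≤s (≡-mod-sym r≡s))

module _ (q : ℕ) .{{_ : NonZero q}} where

  ≡-mod-%ℕ : ∀ a → a ≡ + (a %ℕ q) [mod q ]
  ≡-mod-%ℕ a = ≡-mod (divides (a /ℕ q) (begin
      a - + (a %ℕ q)                                   ≡⟨ cong (_- + (a %ℕ q)) (ℤD.a≡a%ℕn+[a/ℕn]*n a q) ⟩
      (+ (a %ℕ q) + (a /ℕ q) * + q) - + (a %ℕ q)       ≡⟨ lemma (+ (a %ℕ q)) ((a /ℕ q) * + q) ⟩
      (a /ℕ q) * + q                                   ∎))
    where
    open ≡-Reasoning
    lemma : ∀ r m → (r + m) - r ≡ m
    lemma = solve-∀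

  %ℕ≡⇒≡-mod : ∀ {a r} → a %ℕ q ≡ r → a ≡ + r [mod q ]
  %ℕ≡⇒≡-mod {a} a%q≡r = ≡-mod-trans (≡-mod-%ℕ a) (≡-mod-reflexive (cong +_ a%q≡r))

  ≡-mod⇒%ℕ≡ : ∀ {a r} → r < q → a ≡ + r [mod q ] → a %ℕ q ≡ r
  ≡-mod⇒%ℕ≡ {a} r<q a≡r = residue-unique (ℤD.n%ℕd<d a q) r<q (≡-mod-trans (≡-mod-sym (≡-mod-%ℕ a)) a≡r)

  %ℕ-cong-mod : ∀ {a b} → a ≡ b [mod q ] → a %ℕ q ≡ b %ℕ q
  %ℕ-cong-mod {a} {b} a≡b = ≡-mod⇒%ℕ≡ (ℤD.n%ℕd<d b q) (≡-mod-trans a≡b (≡-mod-%ℕ b))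

  %ℕ≡0⇒∣abs : ∀ {a} → a %ℕ q ≡ 0 → q ℕDv.∣ ℤ.∣ a ∣
  %ℕ≡0⇒∣abs {a} a%q≡0 = ℤDv.∣⇒∣ᵤ (≡0-mod⇒∣ (%ℕ≡⇒≡-mod {a} a%q≡0))

  ∣abs⇒%ℕ≡0 : ∀ {a} → q ℕDv.∣ ℤ.∣ a ∣ → a %ℕ q ≡ 0
  ∣abs⇒%ℕ≡0 {a} q∣abs = ≡-mod⇒%ℕ≡ {a} (ℕ.>-nonZero⁻¹ q) (∣⇒≡0-mod (ℤDv.∣ᵤ⇒∣ {i = a} q∣abs))

  residue : ℤ → Fin q
  residue a = fromℕ< (ℤD.n%ℕd<d a q)

  residue-≡-mod : ∀ a → + toℕ (residue a) ≡ a [mod q ]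
  residue-≡-mod a = ≡-mod-sym (%ℕ≡⇒≡-mod (sym (FinP.toℕ-fromℕ< (ℤD.n%ℕd<d a q))))

  residue-cong-mod : ∀ {a b} → a ≡ b [mod q ] → residue a ≡ residue b
  residue-cong-mod {a} {b} a≡b = FinP.toℕ-injective (begin
    toℕ (residue a) ≡⟨ FinP.toℕ-fromℕ< (ℤD.n%ℕd<d a q) ⟩
    a %ℕ q          ≡⟨ %ℕ-cong-mod a≡b ⟩
    b %ℕ q          ≡⟨ FinP.toℕ-fromℕ< (ℤD.n%ℕd<d b q) ⟨
    toℕ (residue b) ∎)
    where open ≡-Reasoning

  residue-+toℕ : ∀ (x : Fin q) → residue (+ toℕ x) ≡ x
  residue-+toℕ x = FinP.toℕ-injective
    (trans (FinP.toℕ-fromℕ< (ℤD.n%ℕd<d (+ toℕ x) q)) (≡-mod⇒%ℕ≡ (FinP.toℕ<n x) ≡-mod-refl))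

-- Linear forms

sumℤ≡∑ : ∀ n (f : Fin n → ℤ) → sumℤ n f ≡ ℤΣ.sum f
sumℤ≡∑ zero    f = refl
sumℤ≡∑ (suc n) f = cong (λ s → f zero + s) (sumℤ≡∑ n (VF.tail f))

evalForm-cong : ∀ {α β x y : Vecℤ ℓ} → α ≗ β → x ≗ y → evalForm α x ≡ evalForm β y
evalForm-cong {zero}  α≗β x≗y = refl
evalForm-cong {suc ℓ} α≗β x≗y =
  cong₂ _+_ (cong₂ _*_ (α≗β zero) (x≗y zero)) (evalForm-cong (α≗β ∘ suc) (x≗y ∘ suc))

evalForm-cong-mod : ∀ {q} (α : Vecℤ ℓ) {x y : Vecℤ ℓ} →
                    (∀ i → x i ≡ y i [mod q ]) → evalForm α x ≡ evalForm α y [mod q ]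
evalForm-cong-mod {zero}  α x≡y = ≡-mod-refl
evalForm-cong-mod {suc ℓ} α x≡y =
  +-cong-mod (*-congˡ-mod (α zero) (x≡y zero)) (evalForm-cong-mod (VF.tail α) (x≡y ∘ suc))

evalForm-linear : ∀ u v (α β x : Vecℤ ℓ) →
                  evalForm (λ k → u * α k + v * β k) x ≡ u * evalForm α x + v * evalForm β x
evalForm-linear {zero}  u v α β x = lemma u v
  where
  lemma : ∀ u v → 0ℤ ≡ u * 0ℤ + v * 0ℤ
  lemma = solve-∀
evalForm-linear {suc ℓ} u v α β x =
  trans (cong (λ s → (u * α zero + v * β zero) * x zero + s) (evalForm-linear u v (VF.tail α) (VF.tail β) (VF.tail x)))
        (lemma u v (α zero) (β zero) (x zero) (evalForm (VF.tail α) (VF.tail x)) (evalForm (VF.tail β) (VF.tail x)))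
  where
  lemma : ∀ u v a b y A B → (u * a + v * b) * y + (u * A + v * B) ≡ u * (a * y + A) + v * (b * y + B)
  lemma = solve-∀

evalForm-zeroˡ : ∀ (x : Vecℤ ℓ) → evalForm (λ _ → 0ℤ) x ≡ 0ℤ
evalForm-zeroˡ {zero}  x = refl
evalForm-zeroˡ {suc ℓ} x = cong (λ s → 0ℤ * x zero + s) (evalForm-zeroˡ (VF.tail x))

idMat-suc : ∀ ℓ (i j : Fin ℓ) → idMat (suc ℓ) (suc i) (suc j) ≡ idMat ℓ i j
idMat-suc ℓ i j with i Fin.≟ j
... | yes _ = refl
... | no  _ = refl

evalForm-idMat : ∀ ℓ (i : Fin ℓ) (x : Vecℤ ℓ) → evalForm (idMat ℓ i) x ≡ x i
evalForm-idMat (suc ℓ) zero    x =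
  trans (cong (λ s → + 1 * x zero + s) (evalForm-zeroˡ (VF.tail x))) (trans (ℤP.+-identityʳ _) (ℤP.*-identityˡ (x zero)))
evalForm-idMat (suc ℓ) (suc i) x = begin
  0ℤ * x zero + evalForm (λ k → idMat (suc ℓ) (suc i) (suc k)) (VF.tail x)
    ≡⟨ ℤP.+-identityˡ _ ⟩
  evalForm (λ k → idMat (suc ℓ) (suc i) (suc k)) (VF.tail x)
    ≡⟨ evalForm-cong (idMat-suc ℓ i) (λ _ → refl) ⟩
  evalForm (idMat ℓ i) (VF.tail x)
    ≡⟨ evalForm-idMat ℓ i (VF.tail x) ⟩
  x (suc i) ∎
  where open ≡-Reasoning

evalForm-formComp : ∀ (α : Vecℤ ℓ) M x → evalForm (formComp α M) x ≡ evalForm α (applyMat M x)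
evalForm-formComp {ℓ} α M x = begin
  evalForm (formComp α M) x
    ≡⟨ sumℤ≡∑ ℓ _ ⟩
  ℤΣ.sum (λ j → formComp α M j * x j)
    ≡⟨ ℤΣ.sum-cong-≗ (λ j → cong (_* x j) (sumℤ≡∑ ℓ (λ k → α k * M k j))) ⟩
  ℤΣ.sum (λ j → ℤΣ.sum (λ k → α k * M k j) * x j)
    ≡⟨ ℤΣ.sum-cong-≗ (λ j → ℤΣ*.*-distribʳ-sum (x j) (λ k → α k * M k j)) ⟩
  ℤΣ.sum (λ j → ℤΣ.sum (λ k → α k * M k j * x j))
    ≡⟨ ℤΣ.∑-comm (λ j k → α k * M k j * x j) ⟩
  ℤΣ.sum (λ k → ℤΣ.sum (λ j → α k * M k j * x j))
    ≡⟨ ℤΣ.sum-cong-≗ (λ k → ℤΣ.sum-cong-≗ (λ j → ℤP.*-assoc (α k) (M k j) (x j))) ⟩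
  ℤΣ.sum (λ k → ℤΣ.sum (λ j → α k * (M k j * x j)))
    ≡⟨ ℤΣ.sum-cong-≗ (λ k → ℤΣ*.*-distribˡ-sum (α k) (λ j → M k j * x j)) ⟨
  ℤΣ.sum (λ k → α k * ℤΣ.sum (λ j → M k j * x j))
    ≡⟨ ℤΣ.sum-cong-≗ (λ k → cong (α k *_) (sumℤ≡∑ ℓ (λ j → M k j * x j))) ⟨
  ℤΣ.sum (λ k → α k * applyMat M x k)
    ≡⟨ sumℤ≡∑ ℓ _ ⟨
  evalForm α (applyMat M x) ∎
  where open ≡-Reasoning

applyMat-·ₘ : ∀ (A B : Mat ℓ) x i → applyMat (A ·ₘ B) x i ≡ applyMat A (applyMat B x) i
applyMat-·ₘ A B x i = evalForm-formComp (A i) B x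

evalForm-sub : ∀ (α β x : Vecℤ ℓ) → evalForm (λ k → α k - β k) x ≡ evalForm α x - evalForm β x
evalForm-sub α β x = begin
  evalForm (λ k → α k - β k) x                    ≡⟨ evalForm-cong (λ k → lemma (α k) (β k)) (λ _ → refl) ⟩
  evalForm (λ k → 1ℤ * α k + -1ℤ * β k) x         ≡⟨ evalForm-linear 1ℤ -1ℤ α β x ⟩
  1ℤ * evalForm α x + -1ℤ * evalForm β x          ≡⟨ lemma (evalForm α x) (evalForm β x) ⟨
  evalForm α x - evalForm β x                     ∎
  where
  open ≡-Reasoning
  lemma : ∀ a b → a - b ≡ 1ℤ * a + -1ℤ * b
  lemma = solve-∀

evalForm-neg : ∀ (β x : Vecℤ ℓ) → evalForm (λ k → - β k) x ≡ - evalForm β x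
evalForm-neg β x = begin
  evalForm (λ k → - β k) x                    ≡⟨ evalForm-cong (λ k → lemma (β k)) (λ _ → refl) ⟩
  evalForm (λ k → -1ℤ * β k + 0ℤ * β k) x     ≡⟨ evalForm-linear -1ℤ 0ℤ β β x ⟩
  -1ℤ * evalForm β x + 0ℤ * evalForm β x      ≡⟨ lemma (evalForm β x) ⟨
  - evalForm β x                              ∎
  where
  open ≡-Reasoning
  lemma : ∀ b → - b ≡ -1ℤ * b + 0ℤ * b
  lemma = solve-∀

-- Counting points of L_q

𝟙 : ∀ {P : Set} → Dec P → ℕ
𝟙 (yes _) = 1
𝟙 (no  _) = 0

𝟙-cong : ∀ {P Q : Set} (P? : Dec P) (Q? : Dec Q) → (P → Q) → (Q → P) → 𝟙 P? ≡ 𝟙 Q?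
𝟙-cong (yes _) (yes _) _   _   = refl
𝟙-cong (yes p) (no ¬q) P→Q _   = ⊥-elim (¬q (P→Q p))
𝟙-cong (no ¬p) (yes q) _   Q→P = ⊥-elim (¬p (Q→P q))
𝟙-cong (no _)  (no _)  _   _   = refl

𝟙-accept : ∀ {P : Set} (P? : Dec P) → P → 𝟙 P? ≡ 1
𝟙-accept (yes _) _ = refl
𝟙-accept (no ¬p) p = ⊥-elim (¬p p)

𝟙-reject : ∀ {P : Set} (P? : Dec P) → ¬ P → 𝟙 P? ≡ 0
𝟙-reject (yes p) ¬p = ⊥-elim (¬p p)
𝟙-reject (no _)  _  = refl

𝟙-× : ∀ {P Q : Set} (P? : Dec P) (Q? : Dec Q) → 𝟙 (P? ×-dec Q?) ≡ 𝟙 P? ℕ.* 𝟙 Q?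
𝟙-× (yes _) (yes _) = refl
𝟙-× (yes _) (no  _) = refl
𝟙-× (no  _) _       = refl

𝟙-split : ∀ {P A : Set} (P? : Dec P) (A? : Dec A) → 𝟙 (P? ×-dec ¬? A?) ℕ.+ 𝟙 (P? ×-dec A?) ≡ 𝟙 P?
𝟙-split (yes _) (yes _) = refl
𝟙-split (yes _) (no  _) = refl
𝟙-split (no  _) _       = refl

∑-const : ∀ n c → ℕΣ.sum {n} (λ _ → c) ≡ n ℕ.* c
∑-const zero    c = refl
∑-const (suc n) c = cong (c ℕ.+_) (∑-const n c)

count : (k q : ℕ) → (Lq k q → ℕ) → ℕ
count zero    q f = f VF.[]
count (suc k) q f = ℕΣ.sum (λ a → count k q (λ v → f (a VF.∷ v)))

count-cong : ∀ {k q} {f g : Lq k q → ℕ} → (∀ x → f x ≡ g x) → count k q f ≡ count k q g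
count-cong {zero}  f≗g = f≗g VF.[]
count-cong {suc k} f≗g = ℕΣ.sum-cong-≗ (λ a → count-cong (λ v → f≗g (a VF.∷ v)))

count-cong-∷ : ∀ {k q} {f g : Lq (suc k) q → ℕ} → (∀ a v → f (a VF.∷ v) ≡ g (a VF.∷ v)) →
               count (suc k) q f ≡ count (suc k) q g
count-cong-∷ f≗g = ℕΣ.sum-cong-≗ (λ a → count-cong (f≗g a))

count-+ : ∀ k q (f g : Lq k q → ℕ) → count k q (λ x → f x ℕ.+ g x) ≡ count k q f ℕ.+ count k q g
count-+ zero    q f g = refl
count-+ (suc k) q f g = trans
  (ℕΣ.sum-cong-≗ (λ a → count-+ k q (λ v → f (a VF.∷ v)) (λ v → g (a VF.∷ v))))
  (ℕΣ.∑-distrib-+ (λ a → count k q (λ v → f (a VF.∷ v))) (λ a → count k q (λ v → g (a VF.∷ v))))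

count-*ˡ : ∀ k q c (f : Lq k q → ℕ) → count k q (λ x → c ℕ.* f x) ≡ c ℕ.* count k q f
count-*ˡ zero    q c f = refl
count-*ˡ (suc k) q c f =
  trans (ℕΣ.sum-cong-≗ (λ a → count-*ˡ k q c (λ v → f (a VF.∷ v))))
        (sym (ℕΣ*.*-distribˡ-sum c (λ a → count k q (λ v → f (a VF.∷ v)))))

count-tail : ∀ k q (f : Lq k q → ℕ) → count (suc k) q (f ∘ VF.tail) ≡ q ℕ.* count k q f
count-tail k q f = ∑-const q (count k q f)

∑-↑ : ∀ m n (g : Fin (m ℕ.+ n) → ℕ) →
      ℕΣ.sum g ≡ ℕΣ.sum (λ i → g (i Fin.↑ˡ n)) ℕ.+ ℕΣ.sum (λ j → g (m Fin.↑ʳ j))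
∑-↑ zero    n g = refl
∑-↑ (suc m) n g =
  trans (cong (g zero ℕ.+_) (∑-↑ m n (g ∘ suc))) (sym (ℕP.+-assoc (g zero) _ _))

∑-combine : ∀ m n (g : Fin (m ℕ.* n) → ℕ) →
            ℕΣ.sum g ≡ ℕΣ.sum {m} (λ i → ℕΣ.sum {n} (λ j → g (combine i j)))
∑-combine zero    n g = refl
∑-combine (suc m) n g =
  trans (∑-↑ n (m ℕ.* n) g)
        (cong (ℕΣ.sum (λ j → g (j Fin.↑ˡ (m ℕ.* n))) ℕ.+_) (∑-combine m n (λ i → g (n Fin.↑ʳ i))))

finToFun-combine : ∀ {q k} (a : Fin q) (j : Fin (q ^ k)) → finToFun {q} {suc k} (combine a j) ≗ a VF.∷ finToFun j
finToFun-combine a j zero    = cong proj₁ (FinP.remQuot-combine a j)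
finToFun-combine a j (suc i) = cong (λ aj → finToFun (proj₂ aj) i) (FinP.remQuot-combine a j)

count≡∑-finToFun : ∀ k q (f : Lq k q → ℕ) → Congruent _≗_ _≡_ f →
                   count k q f ≡ ℕΣ.sum {q ^ k} (f ∘ finToFun)
count≡∑-finToFun zero    q f f-cong = trans (f-cong (λ ())) (sym (ℕP.+-identityʳ _))
count≡∑-finToFun (suc k) q f f-cong = begin
  ℕΣ.sum (λ a → count k q (λ v → f (a VF.∷ v)))
    ≡⟨ ℕΣ.sum-cong-≗ {q} (λ a → count≡∑-finToFun k q (λ v → f (a VF.∷ v)) (λ v≗w → f-cong (∷-cong v≗w))) ⟩
  ℕΣ.sum (λ a → ℕΣ.sum (λ j → f (a VF.∷ finToFun j)))
    ≡⟨ ℕΣ.sum-cong-≗ {q} (λ a → ℕΣ.sum-cong-≗ {q ^ k} (λ j → f-cong (finToFun-combine a j))) ⟨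
  ℕΣ.sum (λ a → ℕΣ.sum (λ j → f (finToFun (combine {q} {q ^ k} a j))))
    ≡⟨ ∑-combine q (q ^ k) (f ∘ finToFun) ⟨
  ℕΣ.sum (f ∘ finToFun) ∎
  where
  open ≡-Reasoning
  ∷-cong : ∀ {a} {v w : Lq k q} → v ≗ w → a VF.∷ v ≗ a VF.∷ w
  ∷-cong v≗w zero    = refl
  ∷-cong v≗w (suc i) = v≗w i

funToFin-cong : ∀ {k q} {g h : Lq k q} → g ≗ h → funToFin g ≡ funToFin h
funToFin-cong {zero}  g≗h = refl
funToFin-cong {suc k} g≗h = cong₂ combine (g≗h zero) (funToFin-cong (g≗h ∘ suc))

count-inverse : ∀ k q (Φ : Inverse (Fin k →-setoid Fin q) (Fin k →-setoid Fin q)) (f : Lq k q → ℕ) →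
                Congruent _≗_ _≡_ f → count k q f ≡ count k q (f ∘ Inverse.to Φ)
count-inverse k q Φ f f-cong = begin
  count k q f                                 ≡⟨ count≡∑-finToFun k q f f-cong ⟩
  ℕΣ.sum (f ∘ finToFun)                       ≡⟨ ℕΣ.∑-permute (f ∘ finToFun) π ⟩
  ℕΣ.sum (f ∘ finToFun ∘ funToFin ∘ to ∘ finToFun)
                                              ≡⟨ ℕΣ.sum-cong-≗ (λ i → f-cong (FinP.finToFun-funToFin (to (finToFun i)))) ⟩
  ℕΣ.sum (f ∘ to ∘ finToFun)                  ≡⟨ count≡∑-finToFun k q (f ∘ to) (f-cong ∘ to-cong) ⟨
  count k q (f ∘ to)                          ∎
  where
  open ≡-Reasoning
  open Inverse Φ
  inverse-on-Fin : ∀ {t u : Lq k q → Lq k q} → Congruent _≗_ _≗_ t → (∀ x → t (u x) ≗ x) →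
                   ∀ i → funToFin (t (finToFun (funToFin (u (finToFun i))))) ≡ i
  inverse-on-Fin {t} {u} t-cong t∘u≗id i =
    trans (funToFin-cong (λ j → trans (t-cong (FinP.finToFun-funToFin (u (finToFun i))) j) (t∘u≗id (finToFun i) j)))
          (FinP.funToFin-finToFin {k} {q} i)
  π : Perm.Permutation (q ^ k) (q ^ k)
  π = Perm.permutation (funToFin ∘ to ∘ finToFun) (funToFin ∘ from ∘ finToFun)
        (inverse-on-Fin to-cong strictlyInverseˡ) (inverse-on-Fin from-cong strictlyInverseʳ)

length-filter≡∑𝟙 : ∀ {A : Set} {P : A → Set} (P? : ∀ x → Dec (P x)) xs →
                   length (filter P? xs) ≡ ℕL.sum (map (𝟙 ∘ P?) xs)
length-filter≡∑𝟙 P? []       = refl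
length-filter≡∑𝟙 P? (x ∷ xs) with P? x
... | yes _ = cong suc (length-filter≡∑𝟙 P? xs)
... | no  _ = length-filter≡∑𝟙 P? xs

∑-map-concatMap : ∀ {A B : Set} (g : B → ℕ) (h : A → List B) xs →
                  ℕL.sum (map g (concatMap h xs)) ≡ ℕL.sum (map (ℕL.sum ∘ map g ∘ h) xs)
∑-map-concatMap g h []       = refl
∑-map-concatMap g h (x ∷ xs) = begin
  ℕL.sum (map g (h x List.++ concatMap h xs))                 ≡⟨ cong ℕL.sum (ListP.map-++ g (h x) _) ⟩
  ℕL.sum (map g (h x) List.++ map g (concatMap h xs))         ≡⟨ ℕLP.sum-++ (map g (h x)) _ ⟩
  ℕL.sum (map g (h x)) ℕ.+ ℕL.sum (map g (concatMap h xs))    ≡⟨ cong (ℕL.sum (map g (h x)) ℕ.+_) (∑-map-concatMap g h xs) ⟩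
  ℕL.sum (map g (h x)) ℕ.+ ℕL.sum (map (ℕL.sum ∘ map g ∘ h) xs) ∎
  where open ≡-Reasoning

∑-map-allFin : ∀ n (f : Fin n → ℕ) → ℕL.sum (map f (allFin n)) ≡ ℕΣ.sum f
∑-map-allFin n f = trans (cong ℕL.sum (ListP.map-tabulate id f)) (∑-tabulate n f)
  where
  ∑-tabulate : ∀ n (f : Fin n → ℕ) → ℕL.sum (List.tabulate f) ≡ ℕΣ.sum f
  ∑-tabulate zero    f = refl
  ∑-tabulate (suc n) f = cong (f zero ℕ.+_) (∑-tabulate n (f ∘ suc))

∑-map-allLq : ∀ k q (f : Lq k q → ℕ) → ℕL.sum (map f (allLq k q)) ≡ count k q f
∑-map-allLq zero    q f = ℕP.+-identityʳ (f VF.[])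
∑-map-allLq (suc k) q f = begin
  ℕL.sum (map f (allLq (suc k) q))
    ≡⟨ ∑-map-concatMap f _ (allFin q) ⟩
  ℕL.sum (map (λ a → ℕL.sum (map f (map (a VF.∷_) (allLq k q)))) (allFin q))
    ≡⟨ ∑-map-allFin q _ ⟩
  ℕΣ.sum (λ a → ℕL.sum (map f (map (a VF.∷_) (allLq k q))))
    ≡⟨ ℕΣ.sum-cong-≗ {q} (λ a → cong ℕL.sum (ListP.map-∘ {g = f} {f = a VF.∷_} (allLq k q))) ⟨
  ℕΣ.sum (λ a → ℕL.sum (map (λ v → f (a VF.∷ v)) (allLq k q)))
    ≡⟨ ℕΣ.sum-cong-≗ (λ a → ∑-map-allLq k q (λ v → f (a VF.∷ v))) ⟩
  count (suc k) q f ∎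
  where open ≡-Reasoning

length-filter-allLq : ∀ k q {P : Lq k q → Set} (P? : ∀ x → Dec (P x)) →
                      length (filter P? (allLq k q)) ≡ count k q (𝟙 ∘ P?)
length-filter-allLq k q P? = trans (length-filter≡∑𝟙 P? (allLq k q)) (∑-map-allLq k q (𝟙 ∘ P?))

-- The congruence d·a ≡ 0 (mod q)

count-multiples : ∀ m .{{_ : NonZero m}} G → ℕΣ.sum {G ℕ.* m} (λ i → 𝟙 (m ∣? toℕ i)) ≡ G
count-multiples m           zero    = refl
count-multiples m@(suc m-1) (suc G) = begin
  ℕΣ.sum {m ℕ.+ G ℕ.* m} (λ i → 𝟙 (m ∣? toℕ i))
    ≡⟨ ∑-↑ m (G ℕ.* m) (λ i → 𝟙 (m ∣? toℕ i)) ⟩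
  ℕΣ.sum {m} (λ i → 𝟙 (m ∣? toℕ (i Fin.↑ˡ (G ℕ.* m)))) ℕ.+ ℕΣ.sum {G ℕ.* m} (λ j → 𝟙 (m ∣? toℕ (m Fin.↑ʳ j)))
    ≡⟨ cong₂ ℕ._+_ first-block (ℕΣ.sum-cong-≗ {G ℕ.* m} later-blocks) ⟩
  suc (ℕΣ.sum {G ℕ.* m} (λ j → 𝟙 (m ∣? toℕ j)))
    ≡⟨ cong suc (count-multiples m G) ⟩
  suc G ∎
  where
  open ≡-Reasoning
  first-block : ℕΣ.sum {m} (λ i → 𝟙 (m ∣? toℕ (i Fin.↑ˡ (G ℕ.* m)))) ≡ 1
  first-block = cong suc (trans (ℕΣ.sum-cong-≗ {m-1} not-multiple) (ℕΣ.sum-replicate-zero m-1))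
    where
    not-multiple : ∀ i → 𝟙 (m ∣? toℕ (suc i Fin.↑ˡ (G ℕ.* m))) ≡ 0
    not-multiple i = 𝟙-reject (m ∣? toℕ (suc i Fin.↑ˡ (G ℕ.* m)))
      (ℕDv.>⇒∤ (subst (ℕ._< m) (sym (FinP.toℕ-↑ˡ (suc i) (G ℕ.* m))) (FinP.toℕ<n (suc i))))
  later-blocks : ∀ j → 𝟙 (m ∣? toℕ (m Fin.↑ʳ j)) ≡ 𝟙 (m ∣? toℕ j)
  later-blocks j rewrite FinP.toℕ-↑ʳ m j =
    𝟙-cong (m ∣? m ℕ.+ toℕ j) (m ∣? toℕ j)
           (λ m∣m+j → ℕDv.∣m+n∣m⇒∣n m∣m+j ℕDv.∣-refl) (ℕDv.∣m∣n⇒∣m+n ℕDv.∣-refl)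

module _ (d q : ℕ) .{{_ : NonZero q}} where

  private
    G : ℕ
    G = gcd d q
    instance
      G≢0 : NonZero G
      G≢0 = ℕ.≢-nonZero (λ G≡0 → ℕ.≢-nonZero⁻¹ q (gcd[m,n]≡0⇒n≡0 d G≡0))
    m : ℕ
    m = q / G
    q≡m*G : q ≡ m ℕ.* G
    q≡m*G = sym (ℕD.m/n*n≡m (gcd[m,n]∣n d q))
    instance
      m≢0 : NonZero m
      m≢0 = ℕ.≢-nonZero (λ m≡0 → ℕ.≢-nonZero⁻¹ q (trans q≡m*G (cong (ℕ._* G) m≡0)))
    d≡d′*G : d ≡ d / G ℕ.* G
    d≡d′*G = sym (ℕD.m/n*n≡m (gcd[m,n]∣m d q))

    q∣d*⇔m∣ : ∀ a → q ℕDv.∣ d ℕ.* a ⇔ m ℕDv.∣ a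
    q∣d*⇔m∣ a = mk⇔ to from
      where
      to : q ℕDv.∣ d ℕ.* a → m ℕDv.∣ a
      to q∣da = Coprime.coprime-divisor (Coprime.sym (Coprime.coprime-/gcd d q))
                  (ℕDv.*-cancelʳ-∣ G (subst₂ ℕDv._∣_ q≡m*G (lemma (d / G)) (subst (λ d → q ℕDv.∣ d ℕ.* a) d≡d′*G q∣da)))
        where
        lemma : ∀ d′ → d′ ℕ.* G ℕ.* a ≡ d′ ℕ.* a ℕ.* G
        lemma d′ = trans (ℕP.*-assoc d′ G a) (trans (cong (d′ ℕ.*_) (ℕP.*-comm G a)) (sym (ℕP.*-assoc d′ a G)))
      from : m ℕDv.∣ a → q ℕDv.∣ d ℕ.* a
      from m∣a = ℕDv.∣-trans (subst (ℕDv._∣ a ℕ.* G) (sym q≡m*G) (ℕDv.*-monoˡ-∣ G m∣a))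
                              (subst (a ℕ.* G ℕDv.∣_) (ℕP.*-comm a d) (ℕDv.*-monoʳ-∣ a (gcd[m,n]∣m d q)))

  -- q ∣ d·a ⇔ (q / gcd(d,q)) ∣ a, and there are gcd(d,q) such a below q.
  count-roots : ℕΣ.sum {q} (λ a → 𝟙 (q ∣? d ℕ.* toℕ a)) ≡ gcd d q
  count-roots = begin
    ℕΣ.sum {q} (λ a → 𝟙 (q ∣? d ℕ.* toℕ a))
      ≡⟨ ℕΣ.sum-cong-≗ {q} (λ a → 𝟙-cong (q ∣? d ℕ.* toℕ a) (m ∣? toℕ a)
                                          (Equivalence.to (q∣d*⇔m∣ (toℕ a))) (Equivalence.from (q∣d*⇔m∣ (toℕ a)))) ⟩
    ℕΣ.sum {q} (λ a → 𝟙 (m ∣? toℕ a))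
      ≡⟨ cong (λ n → ℕΣ.sum {n} (λ a → 𝟙 (m ∣? toℕ a))) (trans q≡m*G (ℕP.*-comm m G)) ⟩
    ℕΣ.sum {G ℕ.* m} (λ a → 𝟙 (m ∣? toℕ a))
      ≡⟨ count-multiples m G ⟩
    G ∎
    where open ≡-Reasoning

-- Systems of homogeneous linear congruences

liftLq-cong : ∀ {q} {x y : Lq k q} → x ≗ y → liftLq x ≗ liftLq y
liftLq-cong x≗y i = cong (λ a → + toℕ a) (x≗y i)

record CoordinateChange (k : ℕ) : Set where
  field
    to from pullback pullback⁻¹ : Vecℤ k → Vecℤ k
    evalForm-pullback   : ∀ α x → evalForm (pullback α) x ≡ evalForm α (to x)
    evalForm-pullback⁻¹ : ∀ α x → evalForm (pullback⁻¹ α) x ≡ evalForm α (from x)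
    to-from : ∀ x → to (from x) ≗ x
    from-to : ∀ x → from (to x) ≗ x

  -- Each coordinate of `to` is a linear form, so `to` respects ≗ and congruences.
  to-coordinate : ∀ x i → to x i ≡ evalForm (pullback (idMat k i)) x
  to-coordinate x i = sym (trans (evalForm-pullback (idMat k i) x) (evalForm-idMat k i (to x)))

  to-cong : Congruent _≗_ _≗_ to
  to-cong {x} {y} x≗y i =
    trans (to-coordinate x i) (trans (evalForm-cong {α = pullback (idMat k i)} (λ _ → refl) x≗y) (sym (to-coordinate y i)))

  to-cong-mod : ∀ {q x y} → (∀ i → x i ≡ y i [mod q ]) → ∀ i → to x i ≡ to y i [mod q ]
  to-cong-mod {q} {x} {y} x≡y i = begin
    to x i                              ≡⟨ to-coordinate x i ⟩
    evalForm (pullback (idMat k i)) x   ≈⟨ evalForm-cong-mod (pullback (idMat k i)) x≡y ⟩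
    evalForm (pullback (idMat k i)) y   ≡⟨ to-coordinate y i ⟨
    to y i                              ∎
    where open ≡-mod-Reasoning q

  inverse : CoordinateChange k
  inverse = record
    { to = from ; from = to ; pullback = pullback⁻¹ ; pullback⁻¹ = pullback
    ; evalForm-pullback = evalForm-pullback⁻¹ ; evalForm-pullback⁻¹ = evalForm-pullback
    ; to-from = from-to ; from-to = to-from
    }

HeadsZero : List (Vecℤ (suc k)) → Set
HeadsZero αs = All (λ α → α zero ≡ 0ℤ) αs

module _ (q : ℕ) .{{_ : NonZero q}} where

  π : Vecℤ k → Lq k q
  π v i = residue q (v i)

  liftLq-π : ∀ (v : Vecℤ k) i → liftLq (π v) i ≡ v i [mod q ]
  liftLq-π v i = residue-≡-mod q (v i)

  π-liftLq : ∀ (x : Lq k q) → π (liftLq x) ≗ x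
  π-liftLq x i = residue-+toℕ q (x i)

  onLq : CoordinateChange k → Inverse (Fin k →-setoid Fin q) (Fin k →-setoid Fin q)
  onLq {k} T = record
    { to        = act T
    ; from      = act T⁻¹
    ; to-cong   = act-cong T
    ; from-cong = act-cong T⁻¹
    ; inverse   = strictlyInverseˡ⇒inverseˡ (act-cong T) (act-inverse T)
                , strictlyInverseʳ⇒inverseʳ (act-cong T⁻¹) (act-inverse T⁻¹)
    }
    where
    open FunctionConsequences (Fin k →-setoid Fin q) (Fin k →-setoid Fin q)
    T⁻¹ : CoordinateChange k
    T⁻¹ = CoordinateChange.inverse T
    act : CoordinateChange k → Lq k q → Lq k q
    act S x = π (CoordinateChange.to S (liftLq x))
    act-cong : ∀ S → Congruent _≗_ _≗_ (act S)
    act-cong S x≗y i = cong (residue q) (CoordinateChange.to-cong S (liftLq-cong x≗y) i)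
    act-inverse : ∀ S x → act S (act (CoordinateChange.inverse S) x) ≗ x
    act-inverse S x i = trans (residue-cong-mod q to∘from≡id) (π-liftLq x i)
      where
      open CoordinateChange S
      to∘from≡id : to (liftLq (π (from (liftLq x)))) i ≡ liftLq x i [mod q ]
      to∘from≡id = ≡-mod-trans (to-cong-mod (liftLq-π (from (liftLq x))) i) (≡-mod-reflexive (to-from (liftLq x) i))

  Vanishes : Vecℤ k → Lq k q → Set
  Vanishes α x = evalForm α (liftLq x) %ℕ q ≡ 0

  vanishes? : (α : Vecℤ k) (x : Lq k q) → Dec (Vanishes α x)
  vanishes? α x = evalForm α (liftLq x) %ℕ q ℕ.≟ 0

  Solves : List (Vecℤ k) → Lq k q → Set
  Solves αs x = All (λ α → Vanishes α x) αs

  solves? : (αs : List (Vecℤ k)) (x : Lq k q) → Dec (Solves αs x)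
  solves? αs x = All.all? (λ α → vanishes? α x) αs

  #solutions : List (Vecℤ k) → ℕ
  #solutions {k} αs = count k q (𝟙 ∘ solves? αs)

  Vanishes-cong : ∀ (α : Vecℤ k) {x y} → x ≗ y → Vanishes α x → Vanishes α y
  Vanishes-cong α x≗y = subst (λ a → a %ℕ q ≡ 0) (evalForm-cong {α = α} (λ _ → refl) (liftLq-cong x≗y))

  Solves-cong : ∀ (αs : List (Vecℤ k)) {x y} → x ≗ y → Solves αs x → Solves αs y
  Solves-cong αs x≗y = All.map (λ {α} → Vanishes-cong α x≗y)

  𝟙-solves-cong : ∀ (αs : List (Vecℤ k)) → Congruent _≗_ _≡_ (𝟙 ∘ solves? αs)
  𝟙-solves-cong αs x≗y =
    𝟙-cong (solves? αs _) (solves? αs _) (Solves-cong αs x≗y) (Solves-cong αs (λ i → sym (x≗y i)))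

  #solutions-cong : ∀ {αs βs : List (Vecℤ k)} →
                    (∀ x → Solves αs x → Solves βs x) → (∀ x → Solves βs x → Solves αs x) →
                    #solutions αs ≡ #solutions βs
  #solutions-cong {αs = αs} {βs} αs⇒βs βs⇒αs =
    count-cong (λ x → 𝟙-cong (solves? αs x) (solves? βs x) (αs⇒βs x) (βs⇒αs x))

  module _ (T : CoordinateChange k) where
    open CoordinateChange T using (pullback; evalForm-pullback)
    open Inverse (onLq T) using () renaming (to to T̄)

    pullback-%ℕ : ∀ α x → evalForm (pullback α) (liftLq x) %ℕ q ≡ evalForm α (liftLq (T̄ x)) %ℕ q
    pullback-%ℕ α x = %ℕ-cong-mod q (begin
      evalForm (pullback α) (liftLq x)
        ≡⟨ evalForm-pullback α (liftLq x) ⟩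
      evalForm α (CoordinateChange.to T (liftLq x))
        ≈⟨ evalForm-cong-mod α (λ i → ≡-mod-sym (liftLq-π (CoordinateChange.to T (liftLq x)) i)) ⟩
      evalForm α (liftLq (T̄ x)) ∎)
      where open ≡-mod-Reasoning q

    #solutions-pullback : ∀ αs → #solutions (map pullback αs) ≡ #solutions αs
    #solutions-pullback αs = begin
      count k q (𝟙 ∘ solves? (map pullback αs))
        ≡⟨ count-cong (λ x → 𝟙-cong (solves? (map pullback αs) x) (solves? αs (T̄ x)) (to x) (from x)) ⟩
      count k q (𝟙 ∘ solves? αs ∘ T̄)
        ≡⟨ count-inverse k q (onLq T) _ (𝟙-solves-cong αs) ⟨
      count k q (𝟙 ∘ solves? αs) ∎
      where
      open ≡-Reasoning
      to : ∀ x → Solves (map pullback αs) x → Solves αs (T̄ x)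
      to x = All.map (λ {α} v → trans (sym (pullback-%ℕ α x)) v) ∘ AllP.map⁻
      from : ∀ x → Solves αs (T̄ x) → Solves (map pullback αs) x
      from x = AllP.map⁺ ∘ All.map (λ {α} v → trans (pullback-%ℕ α x) v)

  private
    evalForm-∷ : ∀ (α : Vecℤ (suc k)) (a : Fin q) (v : Lq k q) → α zero ≡ 0ℤ →
                 evalForm α (liftLq (a VF.∷ v)) ≡ evalForm (VF.tail α) (liftLq v)
    evalForm-∷ α a v α₀≡0 =
      trans (cong (λ c → c * + toℕ a + evalForm (VF.tail α) (liftLq v)) α₀≡0) (ℤP.+-identityˡ _)

    Solves-∷ : ∀ {αs : List (Vecℤ (suc k))} → HeadsZero αs → ∀ (a : Fin q) (v : Lq k q) →
               Solves αs (a VF.∷ v) ⇔ Solves (map VF.tail αs) v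
    Solves-∷ heads a v = mk⇔
      (λ sol → AllP.map⁺ (All.zipWith (λ {α} (α₀≡0 , van) → trans (cong (_%ℕ q) (sym (evalForm-∷ α a v α₀≡0))) van)
                                      (heads , sol)))
      (λ sol → All.zipWith (λ {α} (α₀≡0 , van) → trans (cong (_%ℕ q) (evalForm-∷ α a v α₀≡0)) van)
                           (heads , AllP.map⁻ sol))

  #solutions-headsZero : ∀ (αs : List (Vecℤ (suc k))) → HeadsZero αs →
                         #solutions αs ≡ q ℕ.* #solutions (map VF.tail αs)
  #solutions-headsZero {k} αs heads = trans
    (count-cong-∷ {f = 𝟙 ∘ solves? αs} {g = 𝟙 ∘ solves? (map VF.tail αs) ∘ VF.tail} (λ a v →
      𝟙-cong (solves? αs (a VF.∷ v)) (solves? (map VF.tail αs) v)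
             (Equivalence.to (Solves-∷ heads a v)) (Equivalence.from (Solves-∷ heads a v))))
    (count-tail k q (𝟙 ∘ solves? (map VF.tail αs)))

  Vanishes-pivot : ∀ (p : Vecℤ (suc k)) → (∀ j → p (suc j) ≡ 0ℤ) → ∀ a v →
                   Vanishes p (a VF.∷ v) ⇔ q ℕDv.∣ ℤ.∣ p zero ∣ ℕ.* toℕ a
  Vanishes-pivot p p-tail≡0 a v = mk⇔
    (λ van → subst (q ℕDv.∣_) ∣p[a∷v]∣≡ (%ℕ≡0⇒∣abs q {evalForm p (liftLq (a VF.∷ v))} van))
    (λ q∣ → ∣abs⇒%ℕ≡0 q {evalForm p (liftLq (a VF.∷ v))} (subst (q ℕDv.∣_) (sym ∣p[a∷v]∣≡) q∣))
    where
    open ≡-Reasoning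
    ∣p[a∷v]∣≡ : ℤ.∣ evalForm p (liftLq (a VF.∷ v)) ∣ ≡ ℤ.∣ p zero ∣ ℕ.* toℕ a
    ∣p[a∷v]∣≡ = begin
      ℤ.∣ p zero * + toℕ a + evalForm (VF.tail p) (liftLq v) ∣
        ≡⟨ cong (λ e → ℤ.∣ p zero * + toℕ a + e ∣) (trans (evalForm-cong p-tail≡0 (λ _ → refl)) (evalForm-zeroˡ (liftLq v))) ⟩
      ℤ.∣ p zero * + toℕ a + 0ℤ ∣
        ≡⟨ cong ℤ.∣_∣ (ℤP.+-identityʳ (p zero * + toℕ a)) ⟩
      ℤ.∣ p zero * + toℕ a ∣
        ≡⟨ ℤP.abs-* (p zero) (+ toℕ a) ⟩
      ℤ.∣ p zero ∣ ℕ.* toℕ a ∎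

  #solutions-pivot : ∀ (p : Vecℤ (suc k)) (ws : List (Vecℤ (suc k))) → (∀ j → p (suc j) ≡ 0ℤ) → HeadsZero ws →
                     #solutions (p ∷ ws) ≡ gcd ℤ.∣ p zero ∣ q ℕ.* #solutions (map VF.tail ws)
  #solutions-pivot {k} p ws p-tail≡0 heads = begin
    count (suc k) q (𝟙 ∘ solves? (p ∷ ws))
      ≡⟨ count-cong-∷ {f = 𝟙 ∘ solves? (p ∷ ws)} {g = λ x → 𝟙 (root? (x zero)) ℕ.* sol (VF.tail x)} factorise ⟩
    ℕΣ.sum (λ a → count k q (λ v → 𝟙 (root? a) ℕ.* sol v))
      ≡⟨ ℕΣ.sum-cong-≗ (λ a → count-*ˡ k q (𝟙 (root? a)) sol) ⟩
    ℕΣ.sum (λ a → 𝟙 (root? a) ℕ.* count k q sol)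
      ≡⟨ ℕΣ*.*-distribʳ-sum (count k q sol) (𝟙 ∘ root?) ⟨
    ℕΣ.sum (𝟙 ∘ root?) ℕ.* count k q sol
      ≡⟨ cong (ℕ._* count k q sol) (count-roots ℤ.∣ p zero ∣ q) ⟩
    gcd ℤ.∣ p zero ∣ q ℕ.* #solutions (map VF.tail ws) ∎
    where
    open ≡-Reasoning
    root? : ∀ (a : Fin q) → Dec (q ℕDv.∣ ℤ.∣ p zero ∣ ℕ.* toℕ a)
    root? a = q ∣? ℤ.∣ p zero ∣ ℕ.* toℕ a
    sol : Lq k q → ℕ
    sol = 𝟙 ∘ solves? (map VF.tail ws)
    factorise : ∀ a v → 𝟙 (solves? (p ∷ ws) (a VF.∷ v)) ≡ 𝟙 (root? a) ℕ.* sol v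
    factorise a v = trans
      (𝟙-cong (solves? (p ∷ ws) (a VF.∷ v)) (root? a ×-dec solves? (map VF.tail ws) v)
              (λ { (van ∷ sol) → Equivalence.to (Vanishes-pivot p p-tail≡0 a v) van , Equivalence.to (Solves-∷ heads a v) sol })
              (λ (root , sol) → Equivalence.from (Vanishes-pivot p p-tail≡0 a v) root ∷ Equivalence.from (Solves-∷ heads a v) sol))
      (𝟙-× (root? a) (solves? (map VF.tail ws) v))

-- Smith normal form

record BézoutMatrix (a b : ℤ) : Set where
  field
    u v s t g : ℤ
    det≡1     : u * t - v * s ≡ 1ℤ
    combine-g : u * a + v * b ≡ g
    combine-0 : s * a + t * b ≡ 0ℤ
    g∣a       : g ∣ a
    g∣b       : g ∣ b

private
  sign-unit : ℤ → ℤ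
  sign-unit (+ _)    = 1ℤ
  sign-unit -[1+ _ ] = -1ℤ

  sign-unit*i≡∣i∣ : ∀ i → sign-unit i * i ≡ + ∣ i ∣
  sign-unit*i≡∣i∣ (+ n)    = ℤP.*-identityˡ (+ n)
  sign-unit*i≡∣i∣ -[1+ n ] = ℤP.-1*i≡-i -[1+ n ]

  ℕ-identity⇒ℤ : ∀ {A B D} x y → D ℕ.+ y ℕ.* B ≡ x ℕ.* A → (+ x) * (+ A) + (- (+ y)) * (+ B) ≡ + D
  ℕ-identity⇒ℤ {A} {B} {D} x y eq = lemma (+ x) (+ y) (+ A) (+ B) (+ D) (begin
    (+ D) + (+ y) * (+ B)    ≡⟨ cong (λ yB → (+ D) + yB) (ℤP.pos-* y B) ⟨
    (+ D) + + (y ℕ.* B)      ≡⟨ ℤP.pos-+ D (y ℕ.* B) ⟨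
    + (D ℕ.+ y ℕ.* B)        ≡⟨ cong +_ eq ⟩
    + (x ℕ.* A)              ≡⟨ ℤP.pos-* x A ⟩
    (+ x) * (+ A)            ∎)
    where
    open ≡-Reasoning
    lemma : ∀ X Y A B D → D + Y * B ≡ X * A → X * A + (- Y) * B ≡ D
    lemma X Y A B D eq = trans (cong (λ XA → XA + (- Y) * B) (sym eq)) (cancel D Y B)
      where
      cancel : ∀ D Y B → D + Y * B + (- Y) * B ≡ D
      cancel = solve-∀

  scaled-by-sign-unit : ∀ x a → x * sign-unit a * a ≡ x * + ∣ a ∣
  scaled-by-sign-unit x a = trans (ℤP.*-assoc x (sign-unit a) a) (cong (x *_) (sign-unit*i≡∣i∣ a))

bézout-identity : ∀ a b → ∃₂ λ u v → u * a + v * b ≡ + gcd ∣ a ∣ ∣ b ∣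
bézout-identity a b with ℕGCD.Bézout.identity (gcd-GCD ∣ a ∣ ∣ b ∣)
... | ℕGCD.Bézout.+- x y eq = (+ x) * sign-unit a , (- (+ y)) * sign-unit b ,
  trans (cong₂ _+_ (scaled-by-sign-unit (+ x) a) (scaled-by-sign-unit (- (+ y)) b)) (ℕ-identity⇒ℤ x y eq)
... | ℕGCD.Bézout.-+ x y eq = (- (+ x)) * sign-unit a , (+ y) * sign-unit b ,
  trans (cong₂ _+_ (scaled-by-sign-unit (- (+ x)) a) (scaled-by-sign-unit (+ y) b))
        (trans (ℤP.+-comm ((- (+ x)) * + ∣ a ∣) ((+ y) * + ∣ b ∣)) (ℕ-identity⇒ℤ y x eq))

bézoutMatrix : ∀ a b → BézoutMatrix a b
bézoutMatrix a b with bézout-identity a b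
... | u , v , ua+vb≡g =
  fromIdentity {u = u} {v} (ℤDv.∣ᵤ⇒∣ (gcd[m,n]∣m ∣ a ∣ ∣ b ∣)) (ℤDv.∣ᵤ⇒∣ (gcd[m,n]∣n ∣ a ∣ ∣ b ∣)) ua+vb≡g
  where
  fromIdentity : ∀ {g u v} → g ∣ a → g ∣ b → u * a + v * b ≡ g → BézoutMatrix a b
  fromIdentity {g} {u} {v} g∣a g∣b ua+vb≡g with g ℤ.≟ 0ℤ
  ... | yes refl = record
    { u = 1ℤ ; v = 0ℤ ; s = 0ℤ ; t = 1ℤ ; g = 0ℤ ; det≡1 = refl
    ; combine-g = cong₂ (λ a b → 1ℤ * a + 0ℤ * b) a≡0 b≡0
    ; combine-0 = cong₂ (λ a b → 0ℤ * a + 1ℤ * b) a≡0 b≡0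
    ; g∣a = g∣a ; g∣b = g∣b }
    where
    a≡0 : a ≡ 0ℤ
    a≡0 = ℤDv.0∣⇒≡0 g∣a
    b≡0 : b ≡ 0ℤ
    b≡0 = ℤDv.0∣⇒≡0 g∣b
  ... | no g≢0 = record
    { u = u ; v = v ; s = - b′ ; t = a′ ; g = g
    ; det≡1 = ℤP.*-cancelʳ-≡ _ _ g (begin
        (u * a′ - v * - b′) * g      ≡⟨ expand u v a′ b′ g ⟩
        u * (a′ * g) + v * (b′ * g)  ≡⟨ cong₂ (λ a b → u * a + v * b) a≡a′g b≡b′g ⟨
        u * a + v * b                ≡⟨ ua+vb≡g ⟩
        g                            ≡⟨ ℤP.*-identityˡ g ⟨
        1ℤ * g                       ∎)
    ; combine-g = ua+vb≡g
    ; combine-0 = trans (cong₂ (λ a b → - b′ * a + a′ * b) a≡a′g b≡b′g) (cancel a′ b′ g)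
    ; g∣a = g∣a ; g∣b = g∣b }
    where
    open ≡-Reasoning
    instance
      g-nonZero : ℤ.NonZero g
      g-nonZero = ℤ.≢-nonZero g≢0
    a′ b′ : ℤ
    a′ = ℤDv.quotient g∣a
    b′ = ℤDv.quotient g∣b
    a≡a′g : a ≡ a′ * g
    a≡a′g = ℤDv._∣_.equality g∣a
    b≡b′g : b ≡ b′ * g
    b≡b′g = ℤDv._∣_.equality g∣b
    expand : ∀ u v a′ b′ g → (u * a′ - v * - b′) * g ≡ u * (a′ * g) + v * (b′ * g)
    expand = solve-∀
    cancel : ∀ a′ b′ g → - b′ * (a′ * g) + a′ * (b′ * g) ≡ 0ℤ
    cancel = solve-∀

id-change : CoordinateChange k
id-change = record
  { to = id ; from = id ; pullback = id ; pullback⁻¹ = id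
  ; evalForm-pullback = λ _ _ → refl ; evalForm-pullback⁻¹ = λ _ _ → refl
  ; to-from = λ _ _ → refl ; from-to = λ _ _ → refl }

compose-change : CoordinateChange k → CoordinateChange k → CoordinateChange k
compose-change {k} S T = record
  { to = S.to ∘ T.to ; from = T.from ∘ S.from
  ; pullback = T.pullback ∘ S.pullback ; pullback⁻¹ = S.pullback⁻¹ ∘ T.pullback⁻¹
  ; evalForm-pullback = λ α x → trans (T.evalForm-pullback (S.pullback α) x) (S.evalForm-pullback α (T.to x))
  ; evalForm-pullback⁻¹ = λ α x → trans (S.evalForm-pullback⁻¹ (T.pullback⁻¹ α) x) (T.evalForm-pullback⁻¹ α (S.from x))
  ; to-from = λ x i → trans (S.to-cong (T.to-from (S.from x)) i) (S.to-from x i)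
  ; from-to = λ x i → trans (CoordinateChange.to-cong T⁻¹ (S.from-to (T.to x)) i) (T.from-to x i)
  }
  where
  module S = CoordinateChange S
  module T = CoordinateChange T
  T⁻¹ : CoordinateChange k
  T⁻¹ = CoordinateChange.inverse T

lift-change : CoordinateChange k → CoordinateChange (suc k)
lift-change T = record
  { to = on-tail to ; from = on-tail from ; pullback = on-tail pullback ; pullback⁻¹ = on-tail pullback⁻¹
  ; evalForm-pullback = λ α x → cong (λ e → α zero * x zero + e) (evalForm-pullback (VF.tail α) (VF.tail x))
  ; evalForm-pullback⁻¹ = λ α x → cong (λ e → α zero * x zero + e) (evalForm-pullback⁻¹ (VF.tail α) (VF.tail x))
  ; to-from = λ { x zero → refl ; x (suc i) → to-from (VF.tail x) i }
  ; from-to = λ { x zero → refl ; x (suc i) → from-to (VF.tail x) i }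
  }
  where
  open CoordinateChange T
  on-tail : (Vecℤ k → Vecℤ k) → Vecℤ (suc k) → Vecℤ (suc k)
  on-tail f x = x zero VF.∷ f (VF.tail x)

mat₂ : ℤ → ℤ → ℤ → ℤ → Vecℤ (suc (suc k)) → Vecℤ (suc (suc k))
mat₂ a b c d x zero          = a * x zero + b * x (suc zero)
mat₂ a b c d x (suc zero)    = c * x zero + d * x (suc zero)
mat₂ a b c d x (suc (suc i)) = x (suc (suc i))

evalForm-mat₂ : ∀ a b c d (α x : Vecℤ (suc (suc k))) → evalForm (mat₂ a c b d α) x ≡ evalForm α (mat₂ a b c d x)
evalForm-mat₂ a b c d α x = lemma a b c d (α zero) (α (suc zero)) (x zero) (x (suc zero)) _
  where
  lemma : ∀ a b c d α₀ α₁ x₀ x₁ R →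
          (a * α₀ + c * α₁) * x₀ + ((b * α₀ + d * α₁) * x₁ + R) ≡ α₀ * (a * x₀ + b * x₁) + (α₁ * (c * x₀ + d * x₁) + R)
  lemma = solve-∀

module _ {a b c d : ℤ} (det≡1 : a * d - c * b ≡ 1ℤ) where

  private
    by-det : ∀ x → (a * d - c * b) * x ≡ x
    by-det x = trans (cong (_* x) det≡1) (ℤP.*-identityˡ x)

  mat₂-inverseʳ : ∀ (x : Vecℤ (suc (suc k))) → mat₂ a b c d (mat₂ d (- b) (- c) a x) ≗ x
  mat₂-inverseʳ x zero          = trans (lemma a b c d (x zero) (x (suc zero))) (by-det (x zero))
    where
    lemma : ∀ a b c d x₀ x₁ → a * (d * x₀ + - b * x₁) + b * (- c * x₀ + a * x₁) ≡ (a * d - c * b) * x₀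
    lemma = solve-∀
  mat₂-inverseʳ x (suc zero)    = trans (lemma a b c d (x zero) (x (suc zero))) (by-det (x (suc zero)))
    where
    lemma : ∀ a b c d x₀ x₁ → c * (d * x₀ + - b * x₁) + d * (- c * x₀ + a * x₁) ≡ (a * d - c * b) * x₁
    lemma = solve-∀
  mat₂-inverseʳ x (suc (suc i)) = refl

  mat₂-inverseˡ : ∀ (x : Vecℤ (suc (suc k))) → mat₂ d (- b) (- c) a (mat₂ a b c d x) ≗ x
  mat₂-inverseˡ x zero          = trans (lemma a b c d (x zero) (x (suc zero))) (by-det (x zero))
    where
    lemma : ∀ a b c d x₀ x₁ → d * (a * x₀ + b * x₁) + - b * (c * x₀ + d * x₁) ≡ (a * d - c * b) * x₀
    lemma = solve-∀
  mat₂-inverseˡ x (suc zero)    = trans (lemma a b c d (x zero) (x (suc zero))) (by-det (x (suc zero)))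
    where
    lemma : ∀ a b c d x₀ x₁ → - c * (a * x₀ + b * x₁) + a * (c * x₀ + d * x₁) ≡ (a * d - c * b) * x₁
    lemma = solve-∀
  mat₂-inverseˡ x (suc (suc i)) = refl

sl₂-change : ∀ u v s t → u * t - v * s ≡ 1ℤ → CoordinateChange (suc (suc k))
sl₂-change u v s t det≡1 = record
  { to = mat₂ u s v t ; from = mat₂ t (- s) (- v) u
  ; pullback = mat₂ u v s t ; pullback⁻¹ = mat₂ t (- v) (- s) u
  ; evalForm-pullback = evalForm-mat₂ u s v t
  ; evalForm-pullback⁻¹ = evalForm-mat₂ t (- s) (- v) u
  ; to-from = mat₂-inverseʳ det≡1
  ; from-to = mat₂-inverseˡ det≡1
  }

bézout-change : ∀ {a b} → BézoutMatrix a b → CoordinateChange (suc (suc k))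
bézout-change B = sl₂-change u v s t det≡1
  where open BézoutMatrix B

clear-tail : ∀ (r : Vecℤ (suc k)) →
             Σ[ T ∈ CoordinateChange (suc k) ] (∀ j → CoordinateChange.pullback T r (suc j) ≡ 0ℤ)
clear-tail {zero}  r = id-change , λ ()
clear-tail {suc k} r with clear-tail (VF.tail r)
... | T , T-clears = compose-change L (bézout-change B) , cleared
  where
  L : CoordinateChange (suc (suc k))
  L = lift-change T
  r′ : Vecℤ (suc (suc k))
  r′ = CoordinateChange.pullback L r
  B : BézoutMatrix (r′ zero) (r′ (suc zero))
  B = bézoutMatrix (r′ zero) (r′ (suc zero))
  cleared : ∀ j → CoordinateChange.pullback (bézout-change B) r′ (suc j) ≡ 0ℤ
  cleared zero    = BézoutMatrix.combine-0 B
  cleared (suc j) = T-clears j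

SameSolutions : List (Vecℤ k) → List (Vecℤ k) → Set
SameSolutions {k} αs βs = ∀ q .{{_ : NonZero q}} (x : Lq k q) → Solves q αs x ⇔ Solves q βs x

module _ {αs βs : List (Vecℤ k)} where

  SameSolutions-trans : ∀ {γs} → SameSolutions αs βs → SameSolutions βs γs → SameSolutions αs γs
  SameSolutions-trans αs~βs βs~γs q x = ⇔-trans (αs~βs q x) (βs~γs q x)

  #solutions-same : SameSolutions αs βs → ∀ q .{{_ : NonZero q}} → #solutions q αs ≡ #solutions q βs
  #solutions-same αs~βs q = #solutions-cong q (Equivalence.to ∘ αs~βs q) (Equivalence.from ∘ αs~βs q)

SameSolutions-∷₂ : ∀ {p p′ w : Vecℤ k} {ws ws′} →
                   SameSolutions (p ∷ ws) (p′ ∷ ws′) → SameSolutions (p ∷ w ∷ ws) (p′ ∷ w ∷ ws′)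
SameSolutions-∷₂ {k} same q x = mk⇔
  (λ { (vp ∷ vw ∷ vws) → insert vw (Equivalence.to (same q x) (vp ∷ vws)) })
  (λ { (vp ∷ vw ∷ vws) → insert vw (Equivalence.from (same q x) (vp ∷ vws)) })
  where
  insert : ∀ {P : Vecℤ k → Set} {a b bs} → P b → All P (a ∷ bs) → All P (a ∷ b ∷ bs)
  insert pb (pa ∷ pbs) = pa ∷ pb ∷ pbs

lincomb : ℤ → ℤ → Vecℤ k → Vecℤ k → Vecℤ k
lincomb u v α β i = u * α i + v * β i

module _ (q : ℕ) .{{_ : NonZero q}} (x : Lq k q) where

  Vanishes-congˡ : ∀ {α β} → α ≗ β → Vanishes q α x → Vanishes q β x
  Vanishes-congˡ α≗β = subst (λ e → e %ℕ q ≡ 0) (evalForm-cong α≗β (λ _ → refl))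

  Vanishes-lincomb : ∀ u v α β → Vanishes q α x → Vanishes q β x → Vanishes q (lincomb u v α β) x
  Vanishes-lincomb u v α β α-van β-van = ≡-mod⇒%ℕ≡ q (ℕ.>-nonZero⁻¹ q) (begin
    evalForm (lincomb u v α β) (liftLq x)
      ≡⟨ evalForm-linear u v α β (liftLq x) ⟩
    u * evalForm α (liftLq x) + v * evalForm β (liftLq x)
      ≈⟨ +-cong-mod (*-congˡ-mod u (%ℕ≡⇒≡-mod q α-van)) (*-congˡ-mod v (%ℕ≡⇒≡-mod q β-van)) ⟩
    u * 0ℤ + v * 0ℤ
      ≡⟨ lemma u v ⟩
    0ℤ ∎)
    where
    open ≡-mod-Reasoning q
    lemma : ∀ u v → u * 0ℤ + v * 0ℤ ≡ 0ℤ
    lemma = solve-∀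

  Vanishes-neg : ∀ β → Vanishes q (-_ ∘ β) x → Vanishes q β x
  Vanishes-neg β van = ≡-mod⇒%ℕ≡ q (ℕ.>-nonZero⁻¹ q) (begin
    evalForm β (liftLq x)
      ≡⟨ ℤP.neg-involutive _ ⟨
    - - evalForm β (liftLq x)
      ≈⟨ neg-cong-mod (≡-mod-trans (≡-mod-reflexive (sym (evalForm-neg β (liftLq x)))) (%ℕ≡⇒≡-mod q van)) ⟩
    - 0ℤ ∎)
    where open ≡-mod-Reasoning q

SameSolutions-rowOp : ∀ u v s t → u * t - v * s ≡ 1ℤ → ∀ (p w : Vecℤ k) ws →
                      SameSolutions (p ∷ w ∷ ws) (lincomb u v p w ∷ lincomb s t p w ∷ ws)
SameSolutions-rowOp {k} u v s t det≡1 p w ws q x = mk⇔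
  (λ { (vp ∷ vw ∷ vws) → Vanishes-lincomb q x u v p w vp vw ∷ Vanishes-lincomb q x s t p w vp vw ∷ vws })
  (λ { (vp′ ∷ vw′ ∷ vws) → Vanishes-congˡ q x recover-p (Vanishes-lincomb q x t (- v) p′ w′ vp′ vw′)
                         ∷ Vanishes-congˡ q x recover-w (Vanishes-lincomb q x (- s) u p′ w′ vp′ vw′) ∷ vws })
  where
  p′ w′ : Vecℤ k
  p′ = lincomb u v p w
  w′ = lincomb s t p w
  by-det : ∀ a → (u * t - v * s) * a ≡ a
  by-det a = trans (cong (_* a) det≡1) (ℤP.*-identityˡ a)
  recover-p : lincomb t (- v) p′ w′ ≗ p
  recover-p i = trans (lemma u v s t (p i) (w i)) (by-det (p i))
    where
    lemma : ∀ u v s t a b → t * (u * a + v * b) + - v * (s * a + t * b) ≡ (u * t - v * s) * a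
    lemma = solve-∀
  recover-w : lincomb (- s) u p′ w′ ≗ w
  recover-w i = trans (lemma u v s t (p i) (w i)) (by-det (w i))
    where
    lemma : ∀ u v s t a b → - s * (u * a + v * b) + u * (s * a + t * b) ≡ (u * t - v * s) * b
    lemma = solve-∀

record RowReduction (p : Vecℤ (suc k)) (ws : List (Vecℤ (suc k))) : Set where
  field
    pivot          : Vecℤ (suc k)
    rows           : List (Vecℤ (suc k))
    same           : SameSolutions (p ∷ ws) (pivot ∷ rows)
    rows-headsZero : HeadsZero rows
    pivot∣p        : pivot zero ∣ p zero

rowReduce : ∀ (p : Vecℤ (suc k)) ws → RowReduction p ws
rowReduce p []       = record
  { pivot = p ; rows = [] ; same = λ q x → ⇔-refl
  ; rows-headsZero = [] ; pivot∣p = ℤDv.∣-refl }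
rowReduce p (w ∷ ws) = record
  { pivot = pivot
  ; rows = lincomb s t p w ∷ rows
  ; same = SameSolutions-trans (SameSolutions-rowOp u v s t det≡1 p w ws) (SameSolutions-∷₂ same)
  ; rows-headsZero = combine-0 ∷ rows-headsZero
  ; pivot∣p = ℤDv.∣-trans pivot∣p (subst (_∣ p zero) (sym combine-g) g∣a)
  }
  where
  open BézoutMatrix (bézoutMatrix (p zero) (w zero))
  open RowReduction (rowReduce (lincomb u v p w) ws)

-- The count read off a Smith normal form diag(d₁, …, dᵣ, 0, …, 0) with k - r = corank zero columns.
record ElementaryDivisors (k : ℕ) (αs : List (Vecℤ k)) : Set where
  field
    corank      : ℕ
    corank≤k    : corank ≤ k
    divisors    : List ℕ
    divisors≢0  : All NonZero divisors
    #solutions≡ : ∀ q .{{_ : NonZero q}} →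
                  #solutions q αs ≡ q ^ corank ℕ.* ℕL.product (map (λ d → gcd d q) divisors)

module _ {αs : List (Vecℤ k)} where

  ElementaryDivisors-same : ∀ {βs} → SameSolutions αs βs → ElementaryDivisors k βs → ElementaryDivisors k αs
  ElementaryDivisors-same αs~βs D = record
    { ElementaryDivisors D hiding (#solutions≡)
    ; #solutions≡ = λ q → trans (#solutions-same αs~βs q) (#solutions≡ q) }
    where open ElementaryDivisors D

  ElementaryDivisors-pullback : ∀ (T : CoordinateChange k) →
    ElementaryDivisors k (map (CoordinateChange.pullback T) αs) → ElementaryDivisors k αs
  ElementaryDivisors-pullback T D = record
    { ElementaryDivisors D hiding (#solutions≡)
    ; #solutions≡ = λ q → trans (sym (#solutions-pullback q T αs)) (#solutions≡ q) }
    where open ElementaryDivisors D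

ElementaryDivisors-dim0 : ∀ αs → ElementaryDivisors 0 αs
ElementaryDivisors-dim0 αs = record
  { corank = 0 ; corank≤k = ℕ.z≤n ; divisors = [] ; divisors≢0 = []
  ; #solutions≡ = λ q → 𝟙-accept (solves? q αs VF.[]) (All.universal (λ _ → ℕD.m*n%n≡0 0 q) αs) }

ElementaryDivisors-headsZero : ∀ {αs : List (Vecℤ (suc k))} → HeadsZero αs →
  ElementaryDivisors k (map VF.tail αs) → ElementaryDivisors (suc k) αs
ElementaryDivisors-headsZero {αs = αs} heads D = record
  { corank = suc corank ; corank≤k = ℕ.s≤s corank≤k ; divisors = divisors ; divisors≢0 = divisors≢0
  ; #solutions≡ = λ q → begin
      #solutions q αs                                      ≡⟨ #solutions-headsZero q αs heads ⟩
      q ℕ.* #solutions q (map VF.tail αs)                  ≡⟨ cong (q ℕ.*_) (#solutions≡ q) ⟩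
      q ℕ.* (q ^ corank ℕ.* ℕL.product (map (λ d → gcd d q) divisors))
                                                           ≡⟨ ℕP.*-assoc q (q ^ corank) _ ⟨
      q ^ suc corank ℕ.* ℕL.product (map (λ d → gcd d q) divisors) ∎ }
  where
  open ≡-Reasoning
  open ElementaryDivisors D

ElementaryDivisors-pivot : ∀ (p : Vecℤ (suc k)) ws → (∀ j → p (suc j) ≡ 0ℤ) → p zero ≢ 0ℤ → HeadsZero ws →
  ElementaryDivisors k (map VF.tail ws) → ElementaryDivisors (suc k) (p ∷ ws)
ElementaryDivisors-pivot p ws p-tail≡0 p₀≢0 heads D = record
  { corank = corank ; corank≤k = ℕP.m≤n⇒m≤1+n corank≤k
  ; divisors = ∣p₀∣ ∷ divisors
  ; divisors≢0 = ℕ.≢-nonZero (λ ∣p₀∣≡0 → p₀≢0 (ℤP.∣i∣≡0⇒i≡0 ∣p₀∣≡0)) ∷ divisors≢0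
  ; #solutions≡ = λ q → begin
      #solutions q (p ∷ ws)                                     ≡⟨ #solutions-pivot q p ws p-tail≡0 heads ⟩
      gcd ∣p₀∣ q ℕ.* #solutions q (map VF.tail ws)              ≡⟨ cong (gcd ∣p₀∣ q ℕ.*_) (#solutions≡ q) ⟩
      gcd ∣p₀∣ q ℕ.* (q ^ corank ℕ.* ℕL.product (map (λ d → gcd d q) divisors))
                                                                ≡⟨ lemma (gcd ∣p₀∣ q) (q ^ corank) _ ⟩
      q ^ corank ℕ.* (gcd ∣p₀∣ q ℕ.* ℕL.product (map (λ d → gcd d q) divisors)) ∎ }
  where
  open ≡-Reasoning
  open ElementaryDivisors D
  ∣p₀∣ : ℕ
  ∣p₀∣ = ∣ p zero ∣
  lemma : ∀ a b c → a ℕ.* (b ℕ.* c) ≡ b ℕ.* (a ℕ.* c)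
  lemma = ℕRing.solve-∀

private
  ∣⇒∣∣≤∣ : ∀ {a b} → a ∣ b → b ≢ 0ℤ → ∣ a ∣ ≤ ∣ b ∣
  ∣⇒∣∣≤∣ a∣b b≢0 = ℕDv.∣⇒≤ {{ℕ.≢-nonZero (λ ∣b∣≡0 → b≢0 (ℤP.∣i∣≡0⇒i≡0 ∣b∣≡0))}} (ℤDv.∣⇒∣ᵤ a∣b)

  proper-divisor-< : ∀ {d a b} → d ∣ a → d ∣ b → ¬ a ∣ b → a ≢ 0ℤ → ∣ d ∣ < ∣ a ∣
  proper-divisor-< {d} {a} {b} d∣a d∣b a∤b a≢0 = ℕP.≤∧≢⇒< (∣⇒∣∣≤∣ d∣a a≢0)
    (λ ∣d∣≡∣a∣ → a∤b (ℤDv.∣ᵤ⇒∣ (subst (ℕDv._∣ ∣ b ∣) ∣d∣≡∣a∣ (ℤDv.∣⇒∣ᵤ d∣b))))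

divisor-of-gcd-< : ∀ {a b c} (B : BézoutMatrix a b) → a ≢ 0ℤ → ¬ a ∣ b → c ∣ BézoutMatrix.g B →
                   c ≢ 0ℤ × ∣ c ∣ < ∣ a ∣
divisor-of-gcd-< {a} {b} {c} B a≢0 a∤b c∣g =
  c≢0 , ℕP.≤-<-trans (∣⇒∣∣≤∣ c∣g g≢0) (proper-divisor-< g∣a g∣b a∤b a≢0)
  where
  open BézoutMatrix B
  g≢0 : g ≢ 0ℤ
  g≢0 g≡0 = a≢0 (ℤDv.0∣⇒≡0 (subst (_∣ a) g≡0 g∣a))
  c≢0 : c ≢ 0ℤ
  c≢0 c≡0 = g≢0 (ℤDv.0∣⇒≡0 (subst (_∣ g) c≡0 c∣g))

ElementaryDivisors-divisible : (∀ βs → ElementaryDivisors (suc k) βs) → ∀ (p : Vecℤ (suc (suc k))) ws →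
  p zero ≢ 0ℤ → p zero ∣ p (suc zero) → (∀ j → p (suc (suc j)) ≡ 0ℤ) → HeadsZero ws →
  ElementaryDivisors (suc (suc k)) (p ∷ ws)
ElementaryDivisors-divisible {k} rec p ws p₀≢0 (divides m p₁≡mp₀) p-rest≡0 heads =
  ElementaryDivisors-pullback O (ElementaryDivisors-pivot (O* p) (map O* ws) cleared pivot≢0 heads′ (rec _))
  where
  O : CoordinateChange (suc (suc k))
  O = sl₂-change 1ℤ 0ℤ (- m) 1ℤ refl
  open CoordinateChange O using () renaming (pullback to O*)
  cleared : ∀ j → O* p (suc j) ≡ 0ℤ
  cleared zero    = trans (cong (λ p₁ → - m * p zero + 1ℤ * p₁) p₁≡mp₀) (lemma m (p zero))
    where
    lemma : ∀ m p₀ → - m * p₀ + 1ℤ * (m * p₀) ≡ 0ℤ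
    lemma = solve-∀
  cleared (suc j) = p-rest≡0 j
  pivot≢0 : O* p zero ≢ 0ℤ
  pivot≢0 pivot≡0 = p₀≢0 (trans (sym (lemma (p zero) (p (suc zero)))) pivot≡0)
    where
    lemma : ∀ p₀ p₁ → 1ℤ * p₀ + 0ℤ * p₁ ≡ p₀
    lemma = solve-∀
  heads′ : HeadsZero (map O* ws)
  heads′ = AllP.map⁺ (All.map (λ {α} → keeps-head {α}) heads)
    where
    keeps-head : ∀ {α : Vecℤ (suc (suc k))} → α zero ≡ 0ℤ → O* α zero ≡ 0ℤ
    keeps-head {α} α₀≡0 = cong (λ a → 1ℤ * a + 0ℤ * α (suc zero)) α₀≡0

-- Termination: either p₀ divides the entry that column reduction leaves next to it and p becomes a pivot row,
-- or a Bézout step on the first two columns followed by row reduction strictly decreases |p₀|.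
reducePivot : (∀ βs → ElementaryDivisors k βs) → ∀ n (p : Vecℤ (suc k)) ws →
              p zero ≢ 0ℤ → ∣ p zero ∣ ≤ n → HeadsZero ws → ElementaryDivisors (suc k) (p ∷ ws)
reducePivot         rec zero    p ws p₀≢0 ∣p₀∣≤0 _ = ⊥-elim (p₀≢0 (ℤP.∣i∣≡0⇒i≡0 (ℕP.n≤0⇒n≡0 ∣p₀∣≤0)))
reducePivot {zero}  rec (suc n) p ws p₀≢0 _ heads = ElementaryDivisors-pivot p ws (λ ()) p₀≢0 heads (rec _)
reducePivot {suc k} rec (suc n) p ws p₀≢0 ∣p₀∣≤1+n heads with clear-tail (VF.tail p)
... | T , T-clears = ElementaryDivisors-pullback L (reduce (p zero ℤDv.∣? p₁))
  where
  L : CoordinateChange (suc (suc k))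
  L = lift-change T
  open CoordinateChange L using () renaming (pullback to L*)
  p₁ : ℤ
  p₁ = L* p (suc zero)
  reduce : Dec (p zero ∣ p₁) → ElementaryDivisors (suc (suc k)) (L* p ∷ map L* ws)
  reduce (yes p₀∣p₁) = ElementaryDivisors-divisible rec (L* p) (map L* ws) p₀≢0 p₀∣p₁ T-clears (AllP.map⁺ heads)
  reduce (no p₀∤p₁)  = ElementaryDivisors-pullback O (ElementaryDivisors-same same
    (reducePivot rec n pivot rows (proj₁ smaller) (ℕP.≤-pred (ℕP.<-≤-trans (proj₂ smaller) ∣p₀∣≤1+n)) rows-headsZero))
    where
    B : BézoutMatrix (p zero) p₁
    B = bézoutMatrix (p zero) p₁
    O : CoordinateChange (suc (suc k))
    O = bézout-change B
    open CoordinateChange O using () renaming (pullback to O*)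
    open RowReduction (rowReduce (O* (L* p)) (map O* (map L* ws)))
    smaller : pivot zero ≢ 0ℤ × ∣ pivot zero ∣ < ∣ p zero ∣
    smaller = divisor-of-gcd-< B p₀≢0 p₀∤p₁ (subst (pivot zero ∣_) (BézoutMatrix.combine-g B) pivot∣p)

elementaryDivisors : ∀ k αs → ElementaryDivisors k αs
elementaryDivisors zero    αs       = ElementaryDivisors-dim0 αs
elementaryDivisors (suc k) []       = ElementaryDivisors-headsZero [] (elementaryDivisors k [])
elementaryDivisors (suc k) (p ∷ ws) = ElementaryDivisors-same same (fromReduced (pivot zero ℤ.≟ 0ℤ))
  where
  open RowReduction (rowReduce p ws)
  fromReduced : Dec (pivot zero ≡ 0ℤ) → ElementaryDivisors (suc k) (pivot ∷ rows)
  fromReduced (yes pivot₀≡0) = ElementaryDivisors-headsZero (pivot₀≡0 ∷ rows-headsZero) (elementaryDivisors k _)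
  fromReduced (no pivot₀≢0)  =
    reducePivot (elementaryDivisors k) ∣ pivot zero ∣ pivot rows pivot₀≢0 ℕP.≤-refl rows-headsZero

-- Quasi-polynomials with the gcd-property

evalPolyℤ : (d : ℕ) → (Fin (suc d) → ℤ) → ℤ → ℤ
evalPolyℤ zero    c z = c zero
evalPolyℤ (suc d) c z = c zero + z * evalPolyℤ d (VF.tail c) z

evalPolyℤ-sub : ∀ d (c c′ : Fin (suc d) → ℤ) z →
                evalPolyℤ d (λ i → c i - c′ i) z ≡ evalPolyℤ d c z - evalPolyℤ d c′ z
evalPolyℤ-sub zero    c c′ z = refl
evalPolyℤ-sub (suc d) c c′ z =
  trans (cong (λ p → c zero - c′ zero + z * p) (evalPolyℤ-sub d (VF.tail c) (VF.tail c′) z))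
        (lemma (c zero) (c′ zero) z (evalPolyℤ d (VF.tail c) z) (evalPolyℤ d (VF.tail c′) z))
  where
  lemma : ∀ a b z p p′ → a - b + z * (p - p′) ≡ (a + z * p) - (b + z * p′)
  lemma = solve-∀

evalPolyℤ-zero : ∀ d z → evalPolyℤ d (λ _ → 0ℤ) z ≡ 0ℤ
evalPolyℤ-zero zero    z = refl
evalPolyℤ-zero (suc d) z = trans (cong (λ p → 0ℤ + z * p) (evalPolyℤ-zero d z)) (cong (λ p → 0ℤ + p) (ℤP.*-zeroʳ z))

monomial : ∀ {e d} → e ≤ d → ℤ → Fin (suc d) → ℤ
monomial z≤n       a = a VF.∷ λ _ → 0ℤ
monomial (s≤s e≤d) a = 0ℤ VF.∷ monomial e≤d a

evalPolyℤ-monomial : ∀ {e d} (e≤d : e ≤ d) a z → evalPolyℤ d (monomial e≤d a) z ≡ a * z ℤ.^ e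
evalPolyℤ-monomial {d = zero}  z≤n a z = sym (ℤP.*-identityʳ a)
evalPolyℤ-monomial {d = suc d} z≤n a z = begin
  a + z * evalPolyℤ d (λ _ → 0ℤ) z  ≡⟨ cong (λ p → a + z * p) (evalPolyℤ-zero d z) ⟩
  a + z * 0ℤ                        ≡⟨ lemma a z ⟩
  a * z ℤ.^ 0                       ∎
  where
  open ≡-Reasoning
  lemma : ∀ a z → a + z * 0ℤ ≡ a * 1ℤ
  lemma = solve-∀
evalPolyℤ-monomial {suc e} {suc d} (s≤s e≤d) a z = begin
  0ℤ + z * evalPolyℤ d (monomial e≤d a) z ≡⟨ cong (λ p → 0ℤ + z * p) (evalPolyℤ-monomial e≤d a z) ⟩
  0ℤ + z * (a * z ℤ.^ e)                  ≡⟨ lemma a z (z ℤ.^ e) ⟩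
  a * (z * z ℤ.^ e)                       ∎
  where
  open ≡-Reasoning
  lemma : ∀ a z p → 0ℤ + z * (a * p) ≡ a * (z * p)
  lemma = solve-∀

-- Constituents are indexed by gcd(period, q) rather than by q mod period: this builds in the gcd-property.
record GcdQuasiPolynomial (d : ℕ) (F : (q : ℕ) → .{{NonZero q}} → ℤ) : Set where
  field
    period      : ℕ
    period≢0    : NonZero period
    constituent : ℕ → Fin (suc d) → ℤ
    eval        : ∀ q .{{_ : NonZero q}} → F q ≡ evalPolyℤ d (constituent (gcd period q)) (+ q)

gcd[m,n]≡m : ∀ {m n} → m ℕDv.∣ n → gcd m n ≡ m
gcd[m,n]≡m {m} {n} m∣n = GCD.unique (gcd-GCD m n) (GCD.is (ℕDv.∣-refl , m∣n) proj₁)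

gcd-gcd-∣ : ∀ {d P} → d ℕDv.∣ P → ∀ z → gcd d (gcd P z) ≡ gcd d z
gcd-gcd-∣ {d} {P} d∣P z = trans (sym (gcd-assoc d P z)) (cong (λ g → gcd g z) (gcd[m,n]≡m d∣P))

module _ {d : ℕ} where

  GcdQuasiPolynomial-ext : ∀ {F G : (q : ℕ) → .{{NonZero q}} → ℤ} → (∀ q .{{_ : NonZero q}} → F q ≡ G q) →
                           GcdQuasiPolynomial d F → GcdQuasiPolynomial d G
  GcdQuasiPolynomial-ext F≡G P = record
    { GcdQuasiPolynomial P hiding (eval) ; eval = λ q → trans (sym (F≡G q)) (eval q) }
    where open GcdQuasiPolynomial P

  GcdQuasiPolynomial-sub : ∀ {F G : (q : ℕ) → .{{NonZero q}} → ℤ} →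
                           GcdQuasiPolynomial d F → GcdQuasiPolynomial d G → GcdQuasiPolynomial d (λ q → F q - G q)
  GcdQuasiPolynomial-sub {F} {G} P Q = record
    { period = P.period ℕ.* Q.period
    ; period≢0 = ℕP.m*n≢0 P.period Q.period {{P.period≢0}} {{Q.period≢0}}
    ; constituent = λ g i → P.constituent (gcd P.period g) i - Q.constituent (gcd Q.period g) i
    ; eval = λ q → begin
        F q - G q
          ≡⟨ cong₂ _-_ (P.eval q) (Q.eval q) ⟩
        evalPolyℤ d (P.constituent (gcd P.period q)) (+ q) - evalPolyℤ d (Q.constituent (gcd Q.period q)) (+ q)
          ≡⟨ cong₂ (λ g h → evalPolyℤ d (P.constituent g) (+ q) - evalPolyℤ d (Q.constituent h) (+ q))
                   (gcd-gcd-∣ (ℕDv.m∣m*n {P.period} Q.period) q) (gcd-gcd-∣ (ℕDv.n∣m*n P.period {Q.period}) q) ⟨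
        evalPolyℤ d (P.constituent (gcd P.period (gcd PQ q))) (+ q) - evalPolyℤ d (Q.constituent (gcd Q.period (gcd PQ q))) (+ q)
          ≡⟨ evalPolyℤ-sub d _ _ (+ q) ⟨
        evalPolyℤ d (λ i → P.constituent (gcd P.period (gcd PQ q)) i - Q.constituent (gcd Q.period (gcd PQ q)) i) (+ q) ∎ }
    where
    module P = GcdQuasiPolynomial P
    module Q = GcdQuasiPolynomial Q
    PQ : ℕ
    PQ = P.period ℕ.* Q.period
    open ≡-Reasoning

private
  divisors-∣-product : ∀ ds → All (ℕDv._∣ ℕL.product ds) ds
  divisors-∣-product []       = []
  divisors-∣-product (d ∷ ds) =
    ℕDv.m∣m*n (ℕL.product ds) ∷ All.map (λ e∣ → ℕDv.∣-trans e∣ (ℕDv.n∣m*n d)) (divisors-∣-product ds)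

  ∏gcd-gcd : ∀ {P} ds → All (ℕDv._∣ P) ds → ∀ q →
             ℕL.product (map (λ d → gcd d (gcd P q)) ds) ≡ ℕL.product (map (λ d → gcd d q) ds)
  ∏gcd-gcd []       []           q = refl
  ∏gcd-gcd (d ∷ ds) (d∣P ∷ ds∣P) q = cong₂ ℕ._*_ (gcd-gcd-∣ d∣P q) (∏gcd-gcd ds ds∣P q)

  pos-^ : ∀ m e → + (m ℕ.^ e) ≡ (+ m) ℤ.^ e
  pos-^ m zero    = refl
  pos-^ m (suc e) = trans (ℤP.pos-* m (m ℕ.^ e)) (cong (λ p → + m * p) (pos-^ m e))

GcdQuasiPolynomial-#solutions : ∀ (αs : List (Vecℤ k)) → GcdQuasiPolynomial k (λ q → + #solutions q αs)
GcdQuasiPolynomial-#solutions {k} αs = record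
  { period = ℕL.product divisors
  ; period≢0 = ℕLP.product≢0 divisors≢0
  ; constituent = λ g → monomial corank≤k (+ ∏gcd g)
  ; eval = λ q → begin
      + #solutions q αs
        ≡⟨ cong +_ (#solutions≡ q) ⟩
      + (q ℕ.^ corank ℕ.* ∏gcd q)
        ≡⟨ cong +_ (ℕP.*-comm (q ℕ.^ corank) (∏gcd q)) ⟩
      + (∏gcd q ℕ.* q ℕ.^ corank)
        ≡⟨ ℤP.pos-* (∏gcd q) (q ℕ.^ corank) ⟩
      + ∏gcd q * + (q ℕ.^ corank)
        ≡⟨ cong₂ (λ g p → + g * p) (∏gcd-gcd divisors (divisors-∣-product divisors) q) (sym (pos-^ q corank)) ⟨
      + ∏gcd (gcd (ℕL.product divisors) q) * (+ q) ℤ.^ corank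
                                                ≡⟨ evalPolyℤ-monomial corank≤k _ (+ q) ⟨
      evalPolyℤ k (monomial corank≤k (+ ∏gcd (gcd (ℕL.product divisors) q))) (+ q) ∎ }
  where
  open ≡-Reasoning
  open ElementaryDivisors (elementaryDivisors k αs)
  ∏gcd : ℕ → ℕ
  ∏gcd q = ℕL.product (map (λ d → gcd d q) divisors)

module _ (q : ℕ) .{{_ : NonZero q}} where

  Avoids : List (Vecℤ k) → Lq k q → Set
  Avoids βs x = All (λ β → ¬ Vanishes q β x) βs

  avoids? : (βs : List (Vecℤ k)) (x : Lq k q) → Dec (Avoids βs x)
  avoids? βs x = All.all? (λ β → ¬? (vanishes? q β x)) βs

  #solutionsAvoiding : List (Vecℤ k) → List (Vecℤ k) → ℕ
  #solutionsAvoiding {k} αs βs = count k q (λ x → 𝟙 (solves? q αs x ×-dec avoids? βs x))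

  #solutionsAvoiding-[] : ∀ (αs : List (Vecℤ k)) → #solutionsAvoiding αs [] ≡ #solutions q αs
  #solutionsAvoiding-[] αs = count-cong (λ x → 𝟙-cong (solves? q αs x ×-dec avoids? [] x) (solves? q αs x) proj₁ (_, []))

  #solutionsAvoiding-∷ : ∀ (αs : List (Vecℤ k)) β βs →
                         #solutionsAvoiding αs (β ∷ βs) ℕ.+ #solutionsAvoiding (β ∷ αs) βs ≡ #solutionsAvoiding αs βs
  #solutionsAvoiding-∷ {k} αs β βs = trans (sym (count-+ k q _ _)) (count-cong split)
    where
    split : ∀ x → 𝟙 (solves? q αs x ×-dec avoids? (β ∷ βs) x) ℕ.+ 𝟙 (solves? q (β ∷ αs) x ×-dec avoids? βs x)
                ≡ 𝟙 (solves? q αs x ×-dec avoids? βs x)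
    split x = trans
      (cong₂ ℕ._+_
        (𝟙-cong (solves? q αs x ×-dec avoids? (β ∷ βs) x) ((solves? q αs x ×-dec avoids? βs x) ×-dec ¬? (vanishes? q β x))
                (λ { (s , (¬v ∷ a)) → (s , a) , ¬v }) (λ ((s , a) , ¬v) → s , (¬v ∷ a)))
        (𝟙-cong (solves? q (β ∷ αs) x ×-dec avoids? βs x) ((solves? q αs x ×-dec avoids? βs x) ×-dec vanishes? q β x)
                (λ { ((v ∷ s) , a) → (s , a) , v }) (λ ((s , a) , v) → (v ∷ s) , a)))
      (𝟙-split (solves? q αs x ×-dec avoids? βs x) (vanishes? q β x))

GcdQuasiPolynomial-#solutionsAvoiding : ∀ (βs αs : List (Vecℤ k)) →
  GcdQuasiPolynomial k (λ q → + #solutionsAvoiding q αs βs)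
GcdQuasiPolynomial-#solutionsAvoiding []       αs =
  GcdQuasiPolynomial-ext (λ q → cong +_ (sym (#solutionsAvoiding-[] q αs))) (GcdQuasiPolynomial-#solutions αs)
GcdQuasiPolynomial-#solutionsAvoiding (β ∷ βs) αs =
  GcdQuasiPolynomial-ext inclusion-exclusion
    (GcdQuasiPolynomial-sub (GcdQuasiPolynomial-#solutionsAvoiding βs αs) (GcdQuasiPolynomial-#solutionsAvoiding βs (β ∷ αs)))
  where
  inclusion-exclusion : ∀ q .{{_ : NonZero q}} →
    + #solutionsAvoiding q αs βs - + #solutionsAvoiding q (β ∷ αs) βs ≡ + #solutionsAvoiding q αs (β ∷ βs)
  inclusion-exclusion q = begin
    + #solutionsAvoiding q αs βs - + B          ≡⟨ cong (λ n → + n - + B) (#solutionsAvoiding-∷ q αs β βs) ⟨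
    + (A ℕ.+ B) - + B                           ≡⟨ cong (_- + B) (ℤP.pos-+ A B) ⟩
    + A + + B - + B                             ≡⟨ lemma (+ A) (+ B) ⟩
    + A                                         ∎
    where
    open ≡-Reasoning
    A B : ℕ
    A = #solutionsAvoiding q αs (β ∷ βs)
    B = #solutionsAvoiding q (β ∷ αs) βs
    lemma : ∀ a b → a + b - b ≡ a
    lemma = solve-∀

-- The permutation character

fixedPointForms : ∀ {ℓ} → Mat ℓ → List (Vecℤ ℓ)
fixedPointForms {ℓ} M = List.tabulate (λ k j → M k j - idMat ℓ k j)

FixedModulo : ∀ {ℓ} (q : ℕ) → Mat ℓ → Lq ℓ q → Set
FixedModulo q M x = ∀ k → applyMat M (liftLq x) k ≡ liftLq x k [mod q ]

module _ (q : ℕ) .{{_ : NonZero q}} {ℓ : ℕ} where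

  FixedBy⇔FixedModulo : ∀ (M : Mat ℓ) x → FixedBy q M x ⇔ FixedModulo q M x
  FixedBy⇔FixedModulo M x = mk⇔
    (λ fixed k → %ℕ≡⇒≡-mod q {applyMat M (liftLq x) k} (fixed k))
    (λ fixed k → ≡-mod⇒%ℕ≡ q {applyMat M (liftLq x) k} (FinP.toℕ<n (x k)) (fixed k))

  FixedBy⇔Solves : ∀ (M : Mat ℓ) x → FixedBy q M x ⇔ Solves q (fixedPointForms M) x
  FixedBy⇔Solves M x = mk⇔
    (λ fixed → AllP.tabulate⁺ (λ k → fixed⇒vanishes k (Equivalence.to (FixedBy⇔FixedModulo M x) fixed k)))
    (λ sol → Equivalence.from (FixedBy⇔FixedModulo M x) (λ k → vanishes⇒fixed k (AllP.tabulate⁻ sol k)))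
    where
    evalForm-row : ∀ k → evalForm (λ j → M k j - idMat ℓ k j) (liftLq x) ≡ applyMat M (liftLq x) k - liftLq x k
    evalForm-row k = trans (evalForm-sub (M k) (idMat ℓ k) (liftLq x))
                           (cong (λ y → applyMat M (liftLq x) k - y) (evalForm-idMat ℓ k (liftLq x)))
    fixed⇒vanishes : ∀ k → applyMat M (liftLq x) k ≡ liftLq x k [mod q ] → Vanishes q (λ j → M k j - idMat ℓ k j) x
    fixed⇒vanishes k fixed = ≡-mod⇒%ℕ≡ q (ℕ.>-nonZero⁻¹ q)
      (≡-mod-trans (≡-mod-reflexive (evalForm-row k)) (∣⇒≡0-mod (∣-difference fixed)))
    vanishes⇒fixed : ∀ k → Vanishes q (λ j → M k j - idMat ℓ k j) x → applyMat M (liftLq x) k ≡ liftLq x k [mod q ]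
    vanishes⇒fixed k van = ≡-mod (≡0-mod⇒∣ (≡-mod-trans (≡-mod-reflexive (sym (evalForm-row k))) (%ℕ≡⇒≡-mod q van)))

  InComplement⇔Avoids : ∀ {n} (α : Fin n → Vecℤ ℓ) x → InComplement q α x ⇔ Avoids q (List.tabulate α) x
  InComplement⇔Avoids α x = mk⇔ AllP.tabulate⁺ AllP.tabulate⁻

permChar≡#solutionsAvoiding : ∀ {ℓ n} (Γ : Group 0ℓ 0ℓ) ρ (α : Fin n → Vecℤ ℓ) q .{{_ : NonZero q}} γ →
  permChar Γ ρ α q γ ≡ #solutionsAvoiding q (fixedPointForms (ρ γ)) (List.tabulate α)
permChar≡#solutionsAvoiding {ℓ} Γ ρ α q γ =
  trans (length-filter-allLq ℓ q (λ x → inComplement? q α x ×-dec fixedBy? q (ρ γ) x)) (count-cong (λ x →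
    𝟙-cong (inComplement? q α x ×-dec fixedBy? q (ρ γ) x)
           (solves? q (fixedPointForms (ρ γ)) x ×-dec avoids? q (List.tabulate α) x)
           (λ (ic , fb) → Equivalence.to (FixedBy⇔Solves q (ρ γ) x) fb , Equivalence.to (InComplement⇔Avoids q α x) ic)
           (λ (s , a) → Equivalence.from (InComplement⇔Avoids q α x) a , Equivalence.from (FixedBy⇔Solves q (ρ γ) x) s)))

GcdQuasiPolynomial-permChar : ∀ {ℓ n} (Γ : Group 0ℓ 0ℓ) ρ (α : Fin n → Vecℤ ℓ) γ →
  GcdQuasiPolynomial ℓ (λ q → + permChar Γ ρ α q γ)
GcdQuasiPolynomial-permChar Γ ρ α γ =
  GcdQuasiPolynomial-ext (λ q → cong +_ (sym (permChar≡#solutionsAvoiding Γ ρ α q γ)))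
                         (GcdQuasiPolynomial-#solutionsAvoiding (List.tabulate α) (fixedPointForms (ρ γ)))

applyMat-cong : ∀ (M : Mat ℓ) {v w} → v ≗ w → applyMat M v ≗ applyMat M w
applyMat-cong M v≗w i = evalForm-cong {α = M i} (λ _ → refl) v≗w

applyMat-congˡ : ∀ {A B : Mat ℓ} → (∀ i j → A i j ≡ B i j) → ∀ v → applyMat A v ≗ applyMat B v
applyMat-congˡ A≡B v i = evalForm-cong (A≡B i) (λ _ → refl)

applyMat-cong-mod : ∀ {q} (M : Mat ℓ) {v w} → (∀ i → v i ≡ w i [mod q ]) →
                    ∀ i → applyMat M v i ≡ applyMat M w i [mod q ]
applyMat-cong-mod M v≡w i = evalForm-cong-mod (M i) v≡w

formComp-congʳ : ∀ (β : Vecℤ ℓ) {A B : Mat ℓ} → (∀ i j → A i j ≡ B i j) → formComp β A ≗ formComp β B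
formComp-congʳ β A≡B k = evalForm-cong {α = β} (λ _ → refl) (λ j → A≡B j k)

PermutesUpToSign : ∀ {n} → (Vecℤ ℓ → Vecℤ ℓ) → (Fin n → Vecℤ ℓ) → Set
PermutesUpToSign f α = ∀ i → ∃[ j ] (f (α i) ≗ α j ⊎ f (α i) ≗ (-_ ∘ α j))

module _ (q : ℕ) .{{_ : NonZero q}} (T : CoordinateChange ℓ) where

  open CoordinateChange T
  open Inverse (onLq q T) using () renaming (to to T̄)

  InComplement-change : ∀ {n} (α : Fin n → Vecℤ ℓ) → PermutesUpToSign pullback α →
                        ∀ x → InComplement q α x → InComplement q α (T̄ x)
  InComplement-change {n} α permutes x ic i van =
    Sum.[ ic j ∘ vanishes , ic j ∘ Vanishes-neg q x (α j) ∘ vanishes ] (proj₂ (permutes i))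
    where
    j : Fin n
    j = proj₁ (permutes i)
    vanishes : ∀ {β} → pullback (α i) ≗ β → Vanishes q β x
    vanishes α∘T≗β = Vanishes-congˡ q x α∘T≗β (trans (pullback-%ℕ q T (α i) x) van)

  FixedModulo-conjugate : ∀ (A B : Mat ℓ) → (∀ v → applyMat B (to v) ≗ to (applyMat A v)) → ∀ x →
                          FixedModulo q A x ⇔ FixedModulo q B (T̄ x)
  FixedModulo-conjugate A B B∘to≗to∘A x = mk⇔ A-fixed⇒ B-fixed⇒
    where
    open ≡-mod-Reasoning q
    open CoordinateChange (CoordinateChange.inverse T) using () renaming (to-cong to from-cong; to-cong-mod to from-cong-mod)
    lift-T̄ : ∀ i → liftLq (T̄ x) i ≡ to (liftLq x) i [mod q ]
    lift-T̄ = liftLq-π q (to (liftLq x))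
    A-fixed⇒ : FixedModulo q A x → FixedModulo q B (T̄ x)
    A-fixed⇒ A-fixed k = begin
      applyMat B (liftLq (T̄ x)) k   ≈⟨ applyMat-cong-mod B lift-T̄ k ⟩
      applyMat B (to (liftLq x)) k  ≡⟨ B∘to≗to∘A (liftLq x) k ⟩
      to (applyMat A (liftLq x)) k  ≈⟨ to-cong-mod A-fixed k ⟩
      to (liftLq x) k               ≈⟨ lift-T̄ k ⟨
      liftLq (T̄ x) k                ∎
    B-fixed⇒ : FixedModulo q B (T̄ x) → FixedModulo q A x
    B-fixed⇒ B-fixed k = begin
      applyMat A (liftLq x) k                ≡⟨ from-to (applyMat A (liftLq x)) k ⟨
      from (to (applyMat A (liftLq x))) k    ≡⟨ from-cong (B∘to≗to∘A (liftLq x)) k ⟨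
      from (applyMat B (to (liftLq x))) k    ≈⟨ from-cong-mod (applyMat-cong-mod B lift-T̄) k ⟨
      from (applyMat B (liftLq (T̄ x))) k     ≈⟨ from-cong-mod B-fixed k ⟩
      from (liftLq (T̄ x)) k                  ≈⟨ from-cong-mod lift-T̄ k ⟩
      from (to (liftLq x)) k                 ≡⟨ from-to (liftLq x) k ⟩
      liftLq x k                             ∎

module _ {ℓ n : ℕ} (Γ : Group 0ℓ 0ℓ) (ρ : Group.Carrier Γ → Mat ℓ) (ρ-hom : IsRepHom Γ ρ)
         (α : Fin n → Vecℤ ℓ) where

  open Group Γ using (Carrier; _≈_; _∙_; ε; _⁻¹; inverseˡ; inverseʳ) renaming (sym to ≈-sym)
  open GroupProperties Γ using (⁻¹-involutive)

  private
    ρ-cong : ∀ g h → g ≈ h → ∀ i j → ρ g i j ≡ ρ h i j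
    ρ-cong = proj₁ ρ-hom

    applyMat-ρ-∙ : ∀ g h v → applyMat (ρ (g ∙ h)) v ≗ applyMat (ρ g) (applyMat (ρ h) v)
    applyMat-ρ-∙ g h v i = trans (applyMat-congˡ (proj₁ (proj₂ ρ-hom) g h) v i) (applyMat-·ₘ (ρ g) (ρ h) v i)

    applyMat-ρ-≈ε : ∀ {g} → g ≈ ε → ∀ v → applyMat (ρ g) v ≗ v
    applyMat-ρ-≈ε {g} g≈ε v i = begin
      applyMat (ρ g) v i       ≡⟨ applyMat-congˡ (ρ-cong g ε g≈ε) v i ⟩
      applyMat (ρ ε) v i       ≡⟨ applyMat-congˡ (proj₂ (proj₂ ρ-hom)) v i ⟩
      applyMat (idMat ℓ) v i   ≡⟨ evalForm-idMat ℓ i v ⟩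
      v i                      ∎
      where open ≡-Reasoning

  ρ-change : Carrier → CoordinateChange ℓ
  ρ-change g = record
    { to = applyMat (ρ g) ; from = applyMat (ρ (g ⁻¹))
    ; pullback = λ β → formComp β (ρ g) ; pullback⁻¹ = λ β → formComp β (ρ (g ⁻¹))
    ; evalForm-pullback = λ β → evalForm-formComp β (ρ g)
    ; evalForm-pullback⁻¹ = λ β → evalForm-formComp β (ρ (g ⁻¹))
    ; to-from = λ v i → trans (sym (applyMat-ρ-∙ g (g ⁻¹) v i)) (applyMat-ρ-≈ε (inverseʳ g) v i)
    ; from-to = λ v i → trans (sym (applyMat-ρ-∙ (g ⁻¹) g v i)) (applyMat-ρ-≈ε (inverseˡ g) v i)
    }

  -- IsΓInvariant speaks about ρ(g)⁻¹ = ρ(g⁻¹); the pullback along ρ(g) is its instance at g⁻¹.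
  ρ-change-permutes : IsΓInvariant Γ ρ α → ∀ g → PermutesUpToSign (CoordinateChange.pullback (ρ-change g)) α
  ρ-change-permutes invariant g i =
    map₂ (Sum.map (λ e k → trans (ρg≡ρg⁻¹⁻¹ k) (e k)) (λ e k → trans (ρg≡ρg⁻¹⁻¹ k) (e k))) (invariant (g ⁻¹) i)
    where
    ρg≡ρg⁻¹⁻¹ : formComp (α i) (ρ g) ≗ formComp (α i) (ρ (g ⁻¹ ⁻¹))
    ρg≡ρg⁻¹⁻¹ = formComp-congʳ (α i) (ρ-cong g (g ⁻¹ ⁻¹) (≈-sym (⁻¹-involutive g)))

  ρ-conjugate : ∀ g γ v → applyMat (ρ ((g ∙ γ) ∙ g ⁻¹)) (applyMat (ρ g) v) ≗ applyMat (ρ g) (applyMat (ρ γ) v)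
  ρ-conjugate g γ v i = begin
    applyMat (ρ ((g ∙ γ) ∙ g ⁻¹)) (applyMat (ρ g) v) i
      ≡⟨ applyMat-ρ-∙ (g ∙ γ) (g ⁻¹) _ i ⟩
    applyMat (ρ (g ∙ γ)) (applyMat (ρ (g ⁻¹)) (applyMat (ρ g) v)) i
      ≡⟨ applyMat-cong (ρ (g ∙ γ)) (CoordinateChange.from-to (ρ-change g) v) i ⟩
    applyMat (ρ (g ∙ γ)) v i
      ≡⟨ applyMat-ρ-∙ g γ v i ⟩
    applyMat (ρ g) (applyMat (ρ γ) v) i ∎
    where open ≡-Reasoning

  module _ (q : ℕ) .{{_ : NonZero q}} where

    private
      P? : ∀ γ x → Dec (InComplement q α x × FixedBy q (ρ γ) x)
      P? γ x = inComplement? q α x ×-dec fixedBy? q (ρ γ) x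

      permChar≡count : ∀ γ → permChar Γ ρ α q γ ≡ count ℓ q (𝟙 ∘ P? γ)
      permChar≡count γ = length-filter-allLq ℓ q (P? γ)

      InComplement-cong : ∀ {x y} → x ≗ y → InComplement q α x → InComplement q α y
      InComplement-cong x≗y ic i van = ic i (Vanishes-cong q (α i) (λ k → sym (x≗y k)) van)

      FixedBy-cong : ∀ (M : Mat ℓ) {x y} → x ≗ y → FixedBy q M x → FixedBy q M y
      FixedBy-cong M {x} {y} x≗y =
        Equivalence.from (FixedBy⇔Solves q M y) ∘ Solves-cong q (fixedPointForms M) x≗y ∘ Equivalence.to (FixedBy⇔Solves q M x)

      𝟙-P-cong : ∀ γ {x y} → x ≗ y → 𝟙 (P? γ x) ≡ 𝟙 (P? γ y)
      𝟙-P-cong γ x≗y = 𝟙-cong (P? γ _) (P? γ _)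
        (λ (ic , fb) → InComplement-cong x≗y ic , FixedBy-cong (ρ γ) x≗y fb)
        (λ (ic , fb) → InComplement-cong (λ k → sym (x≗y k)) ic , FixedBy-cong (ρ γ) (λ k → sym (x≗y k)) fb)

    permChar-cong : ∀ {g h} → g ≈ h → permChar Γ ρ α q g ≡ permChar Γ ρ α q h
    permChar-cong {g} {h} g≈h = begin
      permChar Γ ρ α q g
        ≡⟨ permChar≡count g ⟩
      count ℓ q (𝟙 ∘ P? g)
        ≡⟨ count-cong (λ x → 𝟙-cong (P? g x) (P? h x) (map₂ (transfer g≈h)) (map₂ (transfer (≈-sym g≈h)))) ⟩
      count ℓ q (𝟙 ∘ P? h)
        ≡⟨ permChar≡count h ⟨
      permChar Γ ρ α q h ∎
      where
      open ≡-Reasoning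
      transfer : ∀ {g h x} → g ≈ h → FixedBy q (ρ g) x → FixedBy q (ρ h) x
      transfer {g} {h} {x} g≈h fixed k = trans (cong (_%ℕ q) (applyMat-congˡ (ρ-cong h g (≈-sym g≈h)) (liftLq x) k)) (fixed k)

    -- x̄ ↦ ρ_q(g) x̄ maps the fixed points of γ in M(A;q) onto those of g γ g⁻¹.
    permChar-conj : IsΓInvariant Γ ρ α → ∀ g γ → permChar Γ ρ α q ((g ∙ γ) ∙ g ⁻¹) ≡ permChar Γ ρ α q γ
    permChar-conj invariant g γ = begin
      permChar Γ ρ α q γ′          ≡⟨ permChar≡count γ′ ⟩
      count ℓ q (𝟙 ∘ P? γ′)        ≡⟨ count-inverse ℓ q (onLq q T) (𝟙 ∘ P? γ′) (𝟙-P-cong γ′) ⟩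
      count ℓ q (𝟙 ∘ P? γ′ ∘ T̄)    ≡⟨ count-cong (λ x → 𝟙-cong (P? γ′ (T̄ x)) (P? γ x) (conj⇒ x) (⇒conj x)) ⟩
      count ℓ q (𝟙 ∘ P? γ)         ≡⟨ permChar≡count γ ⟨
      permChar Γ ρ α q γ           ∎
      where
      open ≡-Reasoning
      γ′ : Carrier
      γ′ = (g ∙ γ) ∙ g ⁻¹
      T : CoordinateChange ℓ
      T = ρ-change g
      open Inverse (onLq q T) using (strictlyInverseʳ) renaming (to to T̄)

      fixed⇔ : ∀ x → FixedBy q (ρ γ) x ⇔ FixedBy q (ρ γ′) (T̄ x)
      fixed⇔ x = ⇔-trans (FixedBy⇔FixedModulo q (ρ γ) x)
                   (⇔-trans (FixedModulo-conjugate q T (ρ γ) (ρ γ′) (ρ-conjugate g γ) x) (⇔-sym (FixedBy⇔FixedModulo q (ρ γ′) (T̄ x))))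

      conj⇒ : ∀ x → InComplement q α (T̄ x) × FixedBy q (ρ γ′) (T̄ x) → InComplement q α x × FixedBy q (ρ γ) x
      conj⇒ x (ic , fb) =
        InComplement-cong (strictlyInverseʳ x) (InComplement-change q (CoordinateChange.inverse T) α (invariant g) (T̄ x) ic)
        , Equivalence.from (fixed⇔ x) fb

      ⇒conj : ∀ x → InComplement q α x × FixedBy q (ρ γ) x → InComplement q α (T̄ x) × FixedBy q (ρ γ′) (T̄ x)
      ⇒conj x (ic , fb) = InComplement-change q T α (ρ-change-permutes invariant g) x ic , Equivalence.to (fixed⇔ x) fb

-- Polynomials vanishing on an arithmetic progression

divideBy : ∀ d → (Fin (suc (suc d)) → ℤ) → ℤ → Fin (suc d) → ℤ
divideBy zero    c a = λ _ → c (suc zero)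
divideBy (suc d) c a = evalPolyℤ (suc d) (VF.tail c) a VF.∷ divideBy d (VF.tail c) a

evalPolyℤ-divideBy : ∀ d c a z →
                     evalPolyℤ (suc d) c z ≡ (z - a) * evalPolyℤ d (divideBy d c a) z + evalPolyℤ (suc d) c a
evalPolyℤ-divideBy zero    c a z = lemma (c zero) (c (suc zero)) a z
  where
  lemma : ∀ c₀ c₁ a z → c₀ + z * c₁ ≡ (z - a) * c₁ + (c₀ + a * c₁)
  lemma = solve-∀
evalPolyℤ-divideBy (suc d) c a z = begin
  c zero + z * T z                                    ≡⟨ cong (λ t → c zero + z * t) (evalPolyℤ-divideBy d (VF.tail c) a z) ⟩
  c zero + z * ((z - a) * Q z + T a)                  ≡⟨ lemma (c zero) z a (T a) (Q z) ⟩
  (z - a) * (T a + z * Q z) + (c zero + a * T a)      ∎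
  where
  open ≡-Reasoning
  T Q : ℤ → ℤ
  T = evalPolyℤ (suc d) (VF.tail c)
  Q = evalPolyℤ d (divideBy d (VF.tail c) a)
  lemma : ∀ c₀ z a Ta Qz → c₀ + z * ((z - a) * Qz + Ta) ≡ (z - a) * (Ta + z * Qz) + (c₀ + a * Ta)
  lemma = solve-∀

private
  c₀≡0 : ∀ {c₀} a {t} → c₀ + a * t ≡ 0ℤ → t ≡ 0ℤ → c₀ ≡ 0ℤ
  c₀≡0 {c₀} a c₀+at≡0 refl = trans (sym (trans (cong (λ t → c₀ + t) (ℤP.*-zeroʳ a)) (ℤP.+-identityʳ c₀))) c₀+at≡0

divideBy≡0⇒≡0 : ∀ d c a → (∀ i → divideBy d c a i ≡ 0ℤ) → evalPolyℤ (suc d) c a ≡ 0ℤ →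
                ∀ i → c i ≡ 0ℤ
divideBy≡0⇒≡0 zero    c a Q≡0 c[a]≡0 zero          = c₀≡0 a c[a]≡0 (Q≡0 zero)
divideBy≡0⇒≡0 zero    c a Q≡0 c[a]≡0 (suc zero)    = Q≡0 zero
divideBy≡0⇒≡0 (suc d) c a Q≡0 c[a]≡0 zero          = c₀≡0 a c[a]≡0 (Q≡0 zero)
divideBy≡0⇒≡0 (suc d) c a Q≡0 c[a]≡0 (suc i)       = divideBy≡0⇒≡0 d (VF.tail c) a (Q≡0 ∘ suc) (Q≡0 zero) i

vanishing-on-progression⇒≡0 : ∀ d (c : Fin (suc d) → ℤ) a h → h ≢ 0ℤ →
                               (∀ k → evalPolyℤ d c (a + + k * h) ≡ 0ℤ) → ∀ i → c i ≡ 0ℤ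
vanishing-on-progression⇒≡0 zero    c a h h≢0 vanishes zero = vanishes 0
vanishing-on-progression⇒≡0 (suc d) c a h h≢0 vanishes =
  divideBy≡0⇒≡0 d c a (vanishing-on-progression⇒≡0 d Q (a + h) h h≢0 Q-vanishes) c[a]≡0
  where
  Q : Fin (suc d) → ℤ
  Q = divideBy d c a
  c[a]≡0 : evalPolyℤ (suc d) c a ≡ 0ℤ
  c[a]≡0 = trans (cong (evalPolyℤ (suc d) c) (sym (trans (cong (λ t → a + t) (ℤP.*-zeroˡ h)) (ℤP.+-identityʳ a)))) (vanishes 0)
  Q-vanishes : ∀ k → evalPolyℤ d Q (a + h + + k * h) ≡ 0ℤ
  Q-vanishes k = Sum.[ ⊥-elim ∘ z-a≢0 , id ]′ (ℤP.i*j≡0⇒i≡0∨j≡0 (z - a) [z-a]*Q[z]≡0)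
    where
    open ≡-Reasoning
    z : ℤ
    z = a + h + + k * h
    z≡ : z ≡ a + + suc k * h
    z≡ = trans (lemma a h (+ k)) (cong (λ n → a + n * h) (sym (ℤP.pos-+ 1 k)))
      where
      lemma : ∀ a h k → a + h + k * h ≡ a + (1ℤ + k) * h
      lemma = solve-∀
    z-a≢0 : z - a ≢ 0ℤ
    z-a≢0 z-a≡0 = Sum.[ (λ ()) , h≢0 ]′ (ℤP.i*j≡0⇒i≡0∨j≡0 (+ suc k) (trans (sym (z-a≡ a h (+ k))) z-a≡0))
      where
      z-a≡ : ∀ a h k → a + h + k * h - a ≡ (1ℤ + k) * h
      z-a≡ = solve-∀
    [z-a]*Q[z]≡0 : (z - a) * evalPolyℤ d Q z ≡ 0ℤ
    [z-a]*Q[z]≡0 = begin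
      (z - a) * evalPolyℤ d Q z                         ≡⟨ ℤP.+-identityʳ _ ⟨
      (z - a) * evalPolyℤ d Q z + 0ℤ                    ≡⟨ cong (λ r → (z - a) * evalPolyℤ d Q z + r) c[a]≡0 ⟨
      (z - a) * evalPolyℤ d Q z + evalPolyℤ (suc d) c a ≡⟨ evalPolyℤ-divideBy d c a z ⟨
      evalPolyℤ (suc d) c z                             ≡⟨ cong (evalPolyℤ (suc d) c) z≡ ⟩
      evalPolyℤ (suc d) c (a + + suc k * h)             ≡⟨ vanishes (suc k) ⟩
      0ℤ                                                ∎

gcd[n,m%n]≡gcd[n,m] : ∀ m n .{{_ : NonZero n}} → gcd n (m % n) ≡ gcd n m
gcd[n,m%n]≡gcd[n,m] m n = GCD.unique
  (GCD.is (gcd[m,n]∣m n (m % n) , ℕDv.∣n∣m%n⇒∣m (gcd[m,n]∣m n (m % n)) (gcd[m,n]∣n n (m % n)))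
          (λ (c∣n , c∣m) → gcd-greatest c∣n (ℕDv.%-presˡ-∣ c∣m c∣n)))
  (gcd-GCD n m)

constituents-unique : ∀ {d} P .{{_ : NonZero P}} (c₁ c₂ : ℕ → Fin (suc d) → ℤ) →
  (∀ z .{{_ : NonZero z}} → evalPolyℤ d (c₁ (gcd P z)) (+ z) ≡ evalPolyℤ d (c₂ (gcd P z)) (+ z)) →
  ∀ r → c₁ (gcd P r) ≗ c₂ (gcd P r)
constituents-unique {d} P c₁ c₂ agree r i =
  ℤP.i-j≡0⇒i≡j _ _ (vanishing-on-progression⇒≡0 d (λ i → c₁ G i - c₂ G i) (+ G) (+ P) P≢0 vanishes i)
  where
  G : ℕ
  G = gcd P r
  instance
    G≢0 : NonZero G
    G≢0 = ℕ.≢-nonZero (λ G≡0 → ℕ.≢-nonZero⁻¹ P (gcd[m,n]≡0⇒m≡0 G≡0))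
  P≢0 : + P ≢ 0ℤ
  P≢0 +P≡0 = ℕ.≢-nonZero⁻¹ P (ℤP.+-injective +P≡0)
  vanishes : ∀ k → evalPolyℤ d (λ i → c₁ G i - c₂ G i) (+ G + + k * + P) ≡ 0ℤ
  vanishes k = begin
    evalPolyℤ d (λ i → c₁ G i - c₂ G i) (+ G + + k * + P)
      ≡⟨ cong (evalPolyℤ d _) +z≡ ⟩
    evalPolyℤ d (λ i → c₁ G i - c₂ G i) (+ z)
      ≡⟨ evalPolyℤ-sub d (c₁ G) (c₂ G) (+ z) ⟩
    evalPolyℤ d (c₁ G) (+ z) - evalPolyℤ d (c₂ G) (+ z)
      ≡⟨ cong (λ g → evalPolyℤ d (c₁ g) (+ z) - evalPolyℤ d (c₂ g) (+ z)) gcd[P,z]≡G ⟨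
    evalPolyℤ d (c₁ (gcd P z)) (+ z) - evalPolyℤ d (c₂ (gcd P z)) (+ z)
                                                                 ≡⟨ cong (_- evalPolyℤ d (c₂ (gcd P z)) (+ z)) (agree z) ⟩
    evalPolyℤ d (c₂ (gcd P z)) (+ z) - evalPolyℤ d (c₂ (gcd P z)) (+ z)
      ≡⟨ ℤP.+-inverseʳ (evalPolyℤ d (c₂ (gcd P z)) (+ z)) ⟩
    0ℤ ∎
    where
    open ≡-Reasoning
    z : ℕ
    z = G ℕ.+ k ℕ.* P
    instance
      z≢0 : NonZero z
      z≢0 = ℕ.≢-nonZero (λ z≡0 → ℕ.≢-nonZero⁻¹ G (ℕP.m+n≡0⇒m≡0 G z≡0))
    +z≡ : + G + + k * + P ≡ + z
    +z≡ = trans (cong (λ kP → + G + kP) (sym (ℤP.pos-* k P))) (sym (ℤP.pos-+ G (k ℕ.* P)))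
    gcd[P,z]≡G : gcd P z ≡ G
    gcd[P,z]≡G = begin
      gcd P z                ≡⟨ gcd[n,m%n]≡gcd[n,m] z P ⟨
      gcd P (z % P)          ≡⟨ cong (gcd P) (ℕD.[m+kn]%n≡m%n G k P) ⟩
      gcd P (G % P)          ≡⟨ gcd[n,m%n]≡gcd[n,m] G P ⟩
      gcd P G                ≡⟨ gcd-comm P G ⟩
      gcd G P                ≡⟨ gcd[m,n]≡m (gcd[m,n]∣m P r) ⟩
      G                      ∎

toℚ : ℤ → ℚ
toℚ i = i ℚ./ 1

private
  toℚ≡mkℚ : ∀ i → toℚ i ≡ mkℚ i 0 (Coprime.sym (Coprime.1-coprimeTo ℤ.∣ i ∣))
  toℚ≡mkℚ i = ℚP.↥p/↧p≡p (mkℚ i 0 _)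

toℚ-+ : ∀ i j → toℚ (i + j) ≡ toℚ i ℚ.+ toℚ j
toℚ-+ i j = trans (ℚP./-cong (sym (cong₂ _+_ (ℤP.*-identityʳ i) (ℤP.*-identityʳ j))) refl)
                  (sym (cong₂ ℚ._+_ (toℚ≡mkℚ i) (toℚ≡mkℚ j)))

toℚ-* : ∀ i j → toℚ (i * j) ≡ toℚ i ℚ.* toℚ j
toℚ-* i j = sym (cong₂ ℚ._*_ (toℚ≡mkℚ i) (toℚ≡mkℚ j))

evalPoly-toℚ : ∀ d (c : Fin (suc d) → ℤ) z → evalPoly d (toℚ ∘ c) (toℚ z) ≡ toℚ (evalPolyℤ d c z)
evalPoly-toℚ zero    c z = refl
evalPoly-toℚ (suc d) c z = begin
  toℚ (c zero) ℚ.+ toℚ z ℚ.* evalPoly d (toℚ ∘ VF.tail c) (toℚ z)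
    ≡⟨ cong (λ p → toℚ (c zero) ℚ.+ toℚ z ℚ.* p) (evalPoly-toℚ d (VF.tail c) z) ⟩
  toℚ (c zero) ℚ.+ toℚ z ℚ.* toℚ (evalPolyℤ d (VF.tail c) z)
    ≡⟨ cong (toℚ (c zero) ℚ.+_) (toℚ-* z _) ⟨
  toℚ (c zero) ℚ.+ toℚ (z * evalPolyℤ d (VF.tail c) z)
    ≡⟨ toℚ-+ (c zero) _ ⟨
  toℚ (c zero + z * evalPolyℤ d (VF.tail c) z) ∎
  where open ≡-Reasoning

common-multiple : ∀ {m} (P : Fin m → ℕ) → (∀ i → NonZero (P i)) →
                  Σ[ M ∈ ℕ ] NonZero M × (∀ i → P i ℕDv.∣ M)
common-multiple P P≢0 =
  ℕL.product (List.tabulate P) , ℕLP.product≢0 (AllP.tabulate⁺ P≢0) , λ i → ℕLP.∈⇒∣product (∈-tabulate⁺ i)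

module PermutationCharacter {ℓ n : ℕ} (Γ : Group 0ℓ 0ℓ) (finite : IsFiniteGroup Γ)
  (ρ : Group.Carrier Γ → Mat ℓ) (ρ-hom : IsRepHom Γ ρ)
  (α : Fin n → Vecℤ ℓ) (invariant : IsΓInvariant Γ ρ α) where

  open Group Γ using (Carrier; _≈_; _∙_; _⁻¹) renaming (sym to ≈-sym)

  private
    enum : Fin (proj₁ finite) → Carrier
    enum = proj₁ (proj₂ finite)

    representative : Carrier → Carrier
    representative γ = enum (proj₁ (proj₂ (proj₂ finite) γ))

    representative≈ : ∀ γ → representative γ ≈ γ
    representative≈ γ = proj₂ (proj₂ (proj₂ finite) γ)

    Q : ∀ γ → GcdQuasiPolynomial ℓ (λ q → + permChar Γ ρ α q γ)
    Q γ = GcdQuasiPolynomial-permChar Γ ρ α γ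

    module Q γ = GcdQuasiPolynomial (Q γ)

    common : Σ[ M ∈ ℕ ] NonZero M × (∀ i → Q.period (enum i) ℕDv.∣ M)
    common = common-multiple (λ i → Q.period (enum i)) (λ i → Q.period≢0 (enum i))

  period : ℕ
  period = proj₁ common

  instance
    period≢0 : NonZero period
    period≢0 = proj₁ (proj₂ common)

  coefficients : Carrier → ℕ → Fin (suc ℓ) → ℤ
  coefficients γ G = Q.constituent (representative γ) (gcd (Q.period (representative γ)) G)

  permChar-eval : ∀ z .{{_ : NonZero z}} γ →
                  + permChar Γ ρ α z γ ≡ evalPolyℤ ℓ (coefficients γ (gcd period z)) (+ z)
  permChar-eval z γ = begin
    + permChar Γ ρ α z γ
      ≡⟨ cong +_ (permChar-cong Γ ρ ρ-hom α z (≈-sym (representative≈ γ))) ⟩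
    + permChar Γ ρ α z (representative γ)
      ≡⟨ Q.eval (representative γ) z ⟩
    evalPolyℤ ℓ (Q.constituent (representative γ) (gcd (Q.period (representative γ)) z)) (+ z)
      ≡⟨ cong (λ g → evalPolyℤ ℓ (Q.constituent (representative γ) g) (+ z)) (gcd-gcd-∣ (proj₂ (proj₂ common) _) z) ⟨
    evalPolyℤ ℓ (coefficients γ (gcd period z)) (+ z) ∎
    where open ≡-Reasoning

  private
    coefficients-unique : ∀ γ₁ γ₂ → (∀ z .{{_ : NonZero z}} → permChar Γ ρ α z γ₁ ≡ permChar Γ ρ α z γ₂) →
                          ∀ r → coefficients γ₁ (gcd period r) ≗ coefficients γ₂ (gcd period r)
    coefficients-unique γ₁ γ₂ same = constituents-unique period (coefficients γ₁) (coefficients γ₂)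
      (λ z → trans (sym (permChar-eval z γ₁)) (trans (cong +_ (same z)) (permChar-eval z γ₂)))

  coefficients-cong : ∀ {g h} → g ≈ h → ∀ r → coefficients g (gcd period r) ≗ coefficients h (gcd period r)
  coefficients-cong g≈h = coefficients-unique _ _ (λ z → permChar-cong Γ ρ ρ-hom α z g≈h)

  coefficients-conj : ∀ g γ r → coefficients ((g ∙ γ) ∙ g ⁻¹) (gcd period r) ≗ coefficients γ (gcd period r)
  coefficients-conj g γ = coefficients-unique _ _ (λ z → permChar-conj Γ ρ ρ-hom α z invariant g γ)

theorem1p1 : (ℓ : ℕ) (Γ : Group 0ℓ 0ℓ) → IsFiniteGroup Γ →
             (ρ : Group.Carrier Γ → Mat ℓ) → IsRepHom Γ ρ → IsInjectiveRep Γ ρ →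
             (n : ℕ) (α : Fin n → Vecℤ ℓ) → (∀ i → ¬ (∀ k → α i k ≡ + 0)) →
             IsΓInvariant Γ ρ α →
             IsQuasiPolyWithGcd Γ (λ q γ → ℕtoℚ (permChar Γ ρ α q γ))
theorem1p1 ℓ Γ finite ρ ρ-hom _ n α _ invariant =
  period , period≢0 , ℓ , f , class-function , evaluates ,
  λ r₁ r₂ gcd≡ γ i → cong (λ G → toℚ (coefficients γ G i)) gcd≡
  where
  open PermutationCharacter Γ finite ρ ρ-hom α invariant
  f : Fin period → Group.Carrier Γ → Fin (suc ℓ) → ℚ
  f r γ i = toℚ (coefficients γ (gcd period (toℕ r)) i)
  class-function : ∀ r → IsClassFunctionPoly Γ ℓ (f r)
  class-function r = (λ g h g≈h i → cong toℚ (coefficients-cong g≈h (toℕ r) i))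
                   , (λ g γ i → cong toℚ (coefficients-conj g γ (toℕ r) i))
  evaluates : ∀ z .{{_ : NonZero z}} γ →
              ℕtoℚ (permChar Γ ρ α z γ) ≡ evalCFPoly Γ ℓ (f (fromℕ< (ℕD.m%n<n z period))) z γ
  evaluates z γ = begin
    toℚ (+ permChar Γ ρ α z γ)
      ≡⟨ cong toℚ (permChar-eval z γ) ⟩
    toℚ (evalPolyℤ ℓ (coefficients γ (gcd period z)) (+ z))
      ≡⟨ evalPoly-toℚ ℓ _ (+ z) ⟨
    evalPoly ℓ (toℚ ∘ coefficients γ (gcd period z)) (toℚ (+ z))
      ≡⟨ cong (λ G → evalPoly ℓ (toℚ ∘ coefficients γ G) (toℚ (+ z))) gcd≡ ⟩
    evalCFPoly Γ ℓ (f (fromℕ< (ℕD.m%n<n z period))) z γ ∎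
    where
    open ≡-Reasoning
    gcd≡ : gcd period z ≡ gcd period (toℕ (fromℕ< (ℕD.m%n<n z period)))
    gcd≡ = trans (sym (gcd[n,m%n]≡gcd[n,m] z period)) (cong (gcd period) (sym (FinP.toℕ-fromℕ< _)))
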